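{- In the combinatorial model of the context, fix $g\ge0$, $n\ge1$, $\delta$, the decorations $u,z_1,\dots,z_n$, and (for multi-ciliated maps) $k_1,\dots,k_n\ge1$ and $S_i=[z_{i,1},\dots,z_{i,k_i}]$. Then each of the sets of maps of degree $(r+1)\delta$ in $\mathcal F^{[r]}_{g,n}(z_1,\dots,z_n)$, $\mathcal W^{[r]}_{g,n}(z_1,\dots,z_n)$, $\mathcal U^{[r]}_{g,n}(u;z_1,\dots,z_n)$ and $\mathcal S^{[r]}_{g,\underline k}(S_1,\dots,S_n)$ is finite.
   Context: Fix $r\ge2$, $N\ge0$, $\lambda_1,\dots,\lambda_N\in\mathbb C$. A map is a finite graph without isolated vertices embedded in an oriented compact surface whose complement is a disjoint union of open discs (faces). Vertices are black (degree between 3 and $r+1$), white, or square (any positive degree); each face is adjacent to at most one white vertex. A white vertex satisfies the star constraint if the corners around it lie in pairwise distinct faces. Sets (all maps connected of genus $g$, unmarked faces decorated by elements of the finite set $\{\lambda_1,\dots,\lambda_N\}$): $\mathcal F^{[r]}_{g,n}(z_1,\dots,z_n)$: only black vertices, $n$ marked faces labeled $1..n$, the $i$-th decorated $z_i$. $\mathcal W^{[r]}_{g,n}(z_1,\dots,z_n)$: black and white vertices, exactly $n$ white vertices all of degree 1 labeled $1..n$, the face adjacent to the $i$-th white vertex decorated $z_i$. $\mathcal U^{[r]}_{g,n}(u;z_1,\dots,z_n)$: as $\mathcal W^{[r]}_{g,n}$ plus exactly one square vertex, decorated $u$, incident to the edge at the first white vertex. $\mathcal S^{[r]}_{g,\underline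 k}(S_1,\dots,S_n)$: no square vertex, $n$ white vertices labeled $1..n$ satisfying the star constraint, the $i$-th of degree $k_i$ with adjacent faces decorated $z_{i,1},\dots,z_{i,k_i}$ clockwise. The degree of a map $G$ of genus $g$ is $\deg G=(r+1)(\#\mathcal E(G)-\#\mathcal V(G))=(r+1)(\#\mathcal F(G)-2+2g)$. -}

module Defs where

open import Data.Bool using (Bool)
open import Data.Nat using (ℕ; zero; suc; _+_; _*_; _≤_; _<_; _≤ᵇ_; _/_)
open import Data.Integer as ℤ using (ℤ; +_)
open import Data.Fin using (Fin; toℕ; fromℕ<)
open import Data.Fin.Properties using (_≟_)
open import Data.List using (List; length; filterᵇ; upTo; allFin)
open import Data.Bool.ListAction using (any; all)
open import Data.List.Relation.Unary.Any using (Any)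
open import Data.Maybe using (Maybe; just; nothing)
open import Data.Product using (Σ; ∃; _×_; _,_)
open import Relation.Nullary using (¬_)
open import Relation.Nullary.Decidable using (⌊_⌋)
open import Relation.Binary.PropositionalEquality using (_≡_; _≢_)
open import Function using (_∘_)
open import Function.Definitions using (Injective)

-- Darts are Fin D; σ is the vertex rotation (clockwise), α the
-- fixed-point-free edge involution, φ = σ ∘ α the face permutation.
-- Vertices = σ-orbits, edges = α-orbits, faces = φ-orbits.
-- Convention: dart d represents the corner between σ⁻¹ d and d at the
-- vertex of d; this corner lies in the face (φ-orbit) of d.

iter : {D : ℕ} → (Fin D → Fin D) → ℕ → Fin D → Fin D
iter f zero d = d
iter f (suc k) d = f (iter f k d)

SameOrbit : {D : ℕ} → (Fin D → Fin D) → Fin D → Fin D → Set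
SameOrbit f d d' = ∃ λ k → iter f k d ≡ d'

-- boolean version (for an injective f on Fin D, orbits have size ≤ D)
sameOrbitᵇ : {D : ℕ} → (Fin D → Fin D) → Fin D → Fin D → Bool
sameOrbitᵇ {D} f d d' = any (λ k → ⌊ iter f k d ≟ d' ⌋) (upTo D)

orbitSize : {D : ℕ} → (Fin D → Fin D) → Fin D → ℕ
orbitSize {D} f d = length (filterᵇ (sameOrbitᵇ f d) (allFin D))

isOrbitMin : {D : ℕ} → (Fin D → Fin D) → Fin D → Bool
isOrbitMin {D} f d = all (λ k → toℕ d ≤ᵇ toℕ (iter f k d)) (upTo D)

numOrbits : {D : ℕ} → (Fin D → Fin D) → ℕ
numOrbits {D} f = length (filterᵇ (isOrbitMin f) (allFin D))

data Reach {D : ℕ} (σ α : Fin D → Fin D) : Fin D → Fin D → Set where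
  here : ∀ {d} → Reach σ α d d
  viaσ : ∀ {d d'} → Reach σ α (σ d) d' → Reach σ α d d'
  viaα : ∀ {d d'} → Reach σ α (α d) d' → Reach σ α d d'

data Colour : Set where
  black white square : Colour

record CMap (A : Set) (D : ℕ) : Set where
  field
    σ α      : Fin D → Fin D
    σ-inj    : Injective _≡_ _≡_ σ
    α-invol  : ∀ d → α (α d) ≡ d
    α-nofix  : ∀ d → α d ≢ d
    nonempty : 1 ≤ D
    conn     : ∀ d d' → Reach σ α d d'
    colour   : Fin D → Colour
    colour-σ : ∀ d → colour (σ d) ≡ colour d
    dec      : Fin D → A
    dec-φ    : ∀ d → dec (σ (α d)) ≡ dec d

  φ : Fin D → Fin D
  φ = σ ∘ α

  #V #E #F : ℕ
  #V = numOrbits σ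
  #E = D / 2
  #F = numOrbits φ

  vdeg : Fin D → ℕ
  vdeg d = orbitSize σ d

open CMap public

-- genus g : V - E + F = 2 - 2g
HasGenus : {A : Set} {D : ℕ} → CMap A D → ℕ → Set
HasGenus M g = #V M + #F M + 2 * g ≡ #E M + 2

mapDegree : {A : Set} {D : ℕ} → ℕ → CMap A D → ℕ → ℤ
mapDegree r M g = (+ (suc r)) ℤ.* ((+ #F M ℤ.+ + (2 * g)) ℤ.- + 2)

record Admissible {A : Set} {D : ℕ} (r : ℕ) (M : CMap A D) : Set where
  field
    black-deg : ∀ d → colour M d ≡ black → 3 ≤ vdeg M d × vdeg M d ≤ suc r
    one-white : ∀ d d' → colour M d ≡ white → colour M d' ≡ white →
                SameOrbit (φ M) d d' → SameOrbit (σ M) d d'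

InΛ : {A : Set} {N : ℕ} → (Fin N → A) → A → Set
InΛ λs a = ∃ λ j → a ≡ λs j

record CIso {A : Set} {D D' : ℕ} (M : CMap A D) (M' : CMap A D') : Set where
  field
    π   : Fin D → Fin D'
    ρ   : Fin D' → Fin D
    ρπ  : ∀ d → ρ (π d) ≡ d
    πρ  : ∀ d → π (ρ d) ≡ d
    πσ  : ∀ d → π (σ M d) ≡ σ M' (π d)
    πα  : ∀ d → π (α M d) ≡ α M' (π d)
    πcol : ∀ d → colour M' (π d) ≡ colour M d
    πdec : ∀ d → dec M' (π d) ≡ dec M d

FiniteUpTo : (X : Set) → (X → X → Set) → Set
FiniteUpTo X _≅_ = ∃ λ (L : List X) → ∀ x → Any (x ≅_) L

module _ (A : Set) (r N : ℕ) (λs : Fin N → A) (g : ℕ) (δ : ℤ) where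

  record FMap (n : ℕ) (z : Fin n → A) : Set where
    field
      D     : ℕ
      M     : CMap A D
      adm   : Admissible r M
      genus : HasGenus M g
      degree : mapDegree r M g ≡ + (suc r) ℤ.* δ
      allBlack : ∀ d → colour M d ≡ black
      label : Fin D → Maybe (Fin n)
      label-φ : ∀ d → label (φ M d) ≡ label d
      label-used : ∀ i → ∃ λ d → label d ≡ just i
      label-one : ∀ i d d' → label d ≡ just i → label d' ≡ just i → SameOrbit (φ M) d d'
      dec-marked : ∀ i d → label d ≡ just i → dec M d ≡ z i
      dec-unmarked : ∀ d → label d ≡ nothing → InΛ λs (dec M d)

  FIso : ∀ {n z} → FMap n z → FMap n z → Set
  FIso X Y = Σ (CIso (FMap.M X) (FMap.M Y)) λ I →
             ∀ d → FMap.label Y (CIso.π I d) ≡ FMap.label X d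

  record WMap (n : ℕ) (z : Fin n → A) : Set where
    field
      D     : ℕ
      M     : CMap A D
      adm   : Admissible r M
      genus : HasGenus M g
      degree : mapDegree r M g ≡ + (suc r) ℤ.* δ
      noSquare : ∀ d → colour M d ≢ square
      wdart : Fin n → Fin D
      wdart-inj : Injective _≡_ _≡_ wdart
      wdart-white : ∀ i → colour M (wdart i) ≡ white
      wdart-deg : ∀ i → vdeg M (wdart i) ≡ 1
      white-labelled : ∀ d → colour M d ≡ white → ∃ λ i → d ≡ wdart i
      dec-marked : ∀ i → dec M (wdart i) ≡ z i
      dec-unmarked : ∀ d → (∀ i → ¬ SameOrbit (φ M) d (wdart i)) → InΛ λs (dec M d)

  WIso : ∀ {n z} → WMap n z → WMap n z → Set
  WIso X Y = Σ (CIso (WMap.M X) (WMap.M Y)) λ I →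
             ∀ i → CIso.π I (WMap.wdart X i) ≡ WMap.wdart Y i

  -- U^[r]_{g,n}(u; z_1..z_n): as W plus exactly one square vertex
  -- (decorated u), incident to the edge at the first white vertex
  record UMap (n : ℕ) (0<n : 0 < n) (u : A) (z : Fin n → A) : Set where
    field
      D     : ℕ
      M     : CMap A D
      adm   : Admissible r M
      genus : HasGenus M g
      degree : mapDegree r M g ≡ + (suc r) ℤ.* δ
      wdart : Fin n → Fin D
      wdart-inj : Injective _≡_ _≡_ wdart
      wdart-white : ∀ i → colour M (wdart i) ≡ white
      wdart-deg : ∀ i → vdeg M (wdart i) ≡ 1
      white-labelled : ∀ d → colour M d ≡ white → ∃ λ i → d ≡ wdart i
      square-at-first : colour M (α M (wdart (fromℕ< 0<n))) ≡ square
      square-unique : ∀ d → colour M d ≡ square → SameOrbit (σ M) (α M (wdart (fromℕ< 0<n))) d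
      dec-marked : ∀ i → dec M (wdart i) ≡ z i
      dec-unmarked : ∀ d → (∀ i → ¬ SameOrbit (φ M) d (wdart i)) → InΛ λs (dec M d)

  UIso : ∀ {n 0<n u z} → UMap n 0<n u z → UMap n 0<n u z → Set
  UIso X Y = Σ (CIso (UMap.M X) (UMap.M Y)) λ I →
             ∀ i → CIso.π I (UMap.wdart X i) ≡ UMap.wdart Y i

  -- S^[r]_{g,k}(S_1..S_n): n ciliated white vertices with star constraint,
  -- the i-th of degree k_i, its corners (clockwise from the cilium)
  -- lying in faces decorated S_i(0), …, S_i(k_i - 1)
  record SMap (n : ℕ) (k : Fin n → ℕ) (S : (i : Fin n) → Fin (k i) → A) : Set where
    field
      D     : ℕ
      M     : CMap A D
      adm   : Admissible r M
      genus : HasGenus M g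
      degree : mapDegree r M g ≡ + (suc r) ℤ.* δ
      noSquare : ∀ d → colour M d ≢ square
      cilium : Fin n → Fin D
      cilium-white : ∀ i → colour M (cilium i) ≡ white
      cilium-distinct : ∀ i j → SameOrbit (σ M) (cilium i) (cilium j) → i ≡ j
      white-labelled : ∀ d → colour M d ≡ white → ∃ λ i → SameOrbit (σ M) (cilium i) d
      cilium-deg : ∀ i → vdeg M (cilium i) ≡ k i
      star : ∀ d d' → colour M d ≡ white → SameOrbit (σ M) d d' →
             SameOrbit (φ M) d d' → d ≡ d'
      dec-marked : ∀ i (j : Fin (k i)) → dec M (iter (σ M) (toℕ j) (cilium i)) ≡ S i j
      dec-unmarked : ∀ d → (∀ d' → colour M d' ≡ white → ¬ SameOrbit (φ M) d d') →
                     InΛ λs (dec M d)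

  SIso : ∀ {n k S} → SMap n k S → SMap n k S → Set
  SIso X Y = Σ (CIso (SMap.M X) (SMap.M Y)) λ I →
             ∀ i → CIso.π I (SMap.cilium X i) ≡ SMap.cilium Y i

-- Finiteness follows from a bound on the number D of darts. Euler's formula reads V + (F + 2g) = E + 2 with
-- E = ⌊D/2⌋, the degree equation (r+1)(F - 2 + 2g) = (r+1)δ gives F + 2g ≤ |δ| + 2, and every vertex is either
-- black, hence has at least three darts, or one of the at most K labelled white or square vertices, so that
-- 3V ≤ D + 3K. Together D ≤ 6(K + |δ| + 2) + 1. A map on D darts is, up to the identity isomorphism, given by
-- finitely many data on Fin D: σ, α, the colouring, the distinguished darts, and for every face either its
-- marker or an index j with decoration λ_j. Enumerating these data below the bound and keeping the valid ones
-- yields a finite list of representatives.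

module Submission where

import Algebra.Properties.AbelianGroup as AbelianGroupProperties
open import Data.Bool using (Bool; true; false; if_then_else_; _∨_; T)
open import Data.Bool.ListAction using (and; or)
open import Data.Bool.Properties using (T-∨)
open import Data.Empty using (⊥-elim)
open import Data.Fin using (Fin; zero; suc; toℕ; fromℕ<; inject; _≟_)
import Data.Fin.Properties as Finₚ
open Finₚ using (injective⇒≤; pigeonhole; toℕ-injective; +↔⊎; *↔×)
open import Data.Integer as ℤ using (ℤ; +_; ∣_∣)
import Data.Integer.Properties as ℤₚ
open import Data.List using (List; []; _∷_; _++_; length; filterᵇ; tabulate; allFin; upTo; map; concatMap)
open import Data.List.Membership.Propositional.Properties using (∈-upTo⁺; ∈-allFin)
open import Data.List.Properties using (map-cong)
open import Data.List.Relation.Unary.Any using (Any; here; there; satisfied)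
import Data.List.Relation.Unary.Any as Any
open import Data.List.Relation.Unary.Any.Properties using (any⁺; any⁻; ++⁺ˡ; ++⁺ʳ; map⁺; concatMap⁺)
import Data.List.Relation.Unary.All as All
open import Data.List.Relation.Unary.All.Properties using (all⁺)
open import Data.Maybe using (Maybe; just; nothing)
open import Data.Nat using (ℕ; zero; suc; _+_; _*_; _∸_; _≤_; _<_; z≤n; s≤s; _≤ᵇ_; _%_; _/_)
open import Data.Nat.DivMod using (m≡m%n+[m/n]*n; m%n<n)
open import Data.Nat.Properties renaming (_≟_ to _≟ℕ_)
open import Data.Nat.Solver using (module +-*-Solver)
open import Data.Product using (Σ; ∃; _×_; _,_; proj₁; proj₂; uncurry)
import Data.Product.Properties as Productₚ
open Productₚ using (,-injective)
open import Data.Product.Relation.Binary.Pointwise.NonDependent using (Pointwise)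
open import Data.Sum using (_⊎_; inj₁; inj₂; [_,_]′)
import Data.Sum
open import Data.Sum.Function.Propositional using (_⊎-↔_)
import Data.Sum.Properties as Sumₚ
open Sumₚ using (inj₁-injective; inj₂-injective)
open import Data.Vec.Functional as Vector using (Vector)
open import Function using (_∘_; id)
open import Function.Bundles using (Equivalence; Injection; _↔_; mk↣)
open import Function.Definitions using (Injective)
open import Function.Properties.Injection using (↣-trans)
open import Function.Properties.Inverse using (↔-refl; ↔-sym; ↔-trans; ↔⇒↣)
open import Relation.Binary.Definitions using (tri<; tri≈; tri>; DecidableEquality)
open import Relation.Binary.PropositionalEquality
open import Relation.Nullary using (¬_; Dec; yes; no; contradiction)
open import Relation.Nullary.Decidable using (⌊_⌋; ¬?; decidable-stable; map′; fromWitness; toWitness; T?; _×-dec_; _→-dec_)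

open import Defs

count : ∀ {D} → (Fin D → Bool) → ℕ
count {zero}  P = 0
count {suc D} P = if P zero then suc (count (P ∘ suc)) else count (P ∘ suc)

length-filterᵇ-tabulate : ∀ {X : Set} {D} (P : X → Bool) (f : Fin D → X) →
                          length (filterᵇ P (tabulate f)) ≡ count (P ∘ f)
length-filterᵇ-tabulate {D = zero}  P f = refl
length-filterᵇ-tabulate {D = suc D} P f with P (f zero)
... | true  = cong suc (length-filterᵇ-tabulate P (f ∘ suc))
... | false = length-filterᵇ-tabulate P (f ∘ suc)

length-filterᵇ-allFin : ∀ {D} (P : Fin D → Bool) → length (filterᵇ P (allFin D)) ≡ count P
length-filterᵇ-allFin P = length-filterᵇ-tabulate P id

count-cong : ∀ {D} {P Q : Fin D → Bool} → P ≗ Q → count P ≡ count Q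
count-cong {zero}  P≗Q = refl
count-cong {suc D} P≗Q = cong₂ (λ b c → if b then suc c else c) (P≗Q zero) (count-cong (P≗Q ∘ suc))

record Enumeration {D : ℕ} (P : Fin D → Bool) (c : ℕ) : Set where
  field
    enum           : Fin c → Fin D
    enum-injective : Injective _≡_ _≡_ enum
    enum-sound     : ∀ t → T (P (enum t))
    enum-complete  : ∀ d → T (P d) → ∃ λ t → enum t ≡ d

enumerate : ∀ {D} (P : Fin D → Bool) → Enumeration P (count P)
enumerate {zero}  P = record { enum = λ () ; enum-injective = λ {} ; enum-sound = λ () ; enum-complete = λ () }
enumerate {suc D} P = extend (P zero) refl (enumerate (P ∘ suc))
  where
  extend : ∀ b → P zero ≡ b → Enumeration (P ∘ suc) (count (P ∘ suc)) →
           Enumeration P (if b then suc (count (P ∘ suc)) else count (P ∘ suc))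
  extend true P₀ E = record { enum = enum′ ; enum-injective = injective ; enum-sound = sound ; enum-complete = complete }
    where
    open Enumeration E
    enum′ : Fin (suc (count (P ∘ suc))) → Fin (suc D)
    enum′ zero    = zero
    enum′ (suc t) = suc (enum t)
    injective : Injective _≡_ _≡_ enum′
    injective {zero}  {zero}  _  = refl
    injective {suc s} {suc t} eq = cong suc (enum-injective (Finₚ.suc-injective eq))
    sound : ∀ t → T (P (enum′ t))
    sound zero    = subst T (sym P₀) _
    sound (suc t) = enum-sound t
    complete : ∀ d → T (P d) → ∃ λ t → enum′ t ≡ d
    complete zero    _  = zero , refl
    complete (suc d) Pd = let (t , eq) = enum-complete d Pd in suc t , cong suc eq
  extend false P₀ E = record { enum = suc ∘ enum ; enum-injective = enum-injective ∘ Finₚ.suc-injective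
                             ; enum-sound = enum-sound ; enum-complete = complete }
    where
    open Enumeration E
    complete : ∀ d → T (P d) → ∃ λ t → suc (enum t) ≡ d
    complete zero    Pd = ⊥-elim (subst T P₀ Pd)
    complete (suc d) Pd = let (t , eq) = enum-complete d Pd in t , cong suc eq

module _ {D : ℕ} (P : Fin D → Bool) where
  open Enumeration (enumerate P)

  count≤size : count P ≤ D
  count≤size = injective⇒≤ enum-injective

  injective⇒≤count : ∀ {m} (h : Fin m → Fin D) → Injective _≡_ _≡_ h → (∀ i → T (P (h i))) → m ≤ count P
  injective⇒≤count h h-inj Ph = injective⇒≤ {f = index} index-injective
    where
    index : _ → Fin (count P)
    index i = proj₁ (enum-complete (h i) (Ph i))
    index-injective : Injective _≡_ _≡_ index
    index-injective {i} {j} eq = h-inj (begin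
      h i                  ≡⟨ proj₂ (enum-complete (h i) (Ph i)) ⟨
      enum (index i)       ≡⟨ cong enum eq ⟩
      enum (index j)       ≡⟨ proj₂ (enum-complete (h j) (Ph j)) ⟩
      h j                  ∎)
      where open ≡-Reasoning

  covering⇒count≤ : ∀ {m} (h : Fin m → Fin D) → (∀ d → T (P d) → ∃ λ i → h i ≡ d) → count P ≤ m
  covering⇒count≤ h covers = injective⇒≤ {f = preimage} preimage-injective
    where
    preimage : Fin (count P) → _
    preimage t = proj₁ (covers (enum t) (enum-sound t))
    preimage-injective : Injective _≡_ _≡_ preimage
    preimage-injective {s} {t} eq = enum-injective (begin
      enum s               ≡⟨ proj₂ (covers (enum s) (enum-sound s)) ⟨
      h (preimage s)       ≡⟨ cong h eq ⟩
      h (preimage t)       ≡⟨ proj₂ (covers (enum t) (enum-sound t)) ⟩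
      enum t               ∎)
      where open ≡-Reasoning

pigeonhole-count : ∀ {D} (P : Fin D → Bool) (h : Fin (suc (count P)) → Fin D) → (∀ i → T (P (h i))) →
                   ∃ λ i → ∃ λ j → toℕ i < toℕ j × h i ≡ h j
pigeonhole-count P h Ph =
  let (i , j , i<j , same-index) = pigeonhole (n<1+n (count P)) index
  in i , j , i<j , (begin
    h i              ≡⟨ proj₂ (enum-complete (h i) (Ph i)) ⟨
    enum (index i)   ≡⟨ cong enum same-index ⟩
    enum (index j)   ≡⟨ proj₂ (enum-complete (h j) (Ph j)) ⟩
    h j              ∎)
  where
  open Enumeration (enumerate P)
  open ≡-Reasoning
  index : _ → Fin (count P)
  index i = proj₁ (enum-complete (h i) (Ph i))

count-strict : ∀ {D} (P Q : Fin D → Bool) → (∀ d → T (P d) → T (Q d)) →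
               (d : Fin D) → T (Q d) → ¬ T (P d) → count P < count Q
count-strict {D} P Q P⊆Q d Qd ¬Pd = injective⇒≤count Q h h-injective Qh
  where
  open Enumeration (enumerate P)
  h : Fin (suc (count P)) → Fin D
  h zero    = d
  h (suc t) = enum t
  d∉enum : ∀ t → d ≢ enum t
  d∉enum t eq = ¬Pd (subst (T ∘ P) (sym eq) (enum-sound t))
  h-injective : Injective _≡_ _≡_ h
  h-injective {zero}  {zero}  _  = refl
  h-injective {zero}  {suc t} eq = contradiction eq (d∉enum t)
  h-injective {suc s} {zero}  eq = contradiction (sym eq) (d∉enum s)
  h-injective {suc s} {suc t} eq = cong suc (enum-injective eq)
  Qh : ∀ i → T (Q (h i))
  Qh zero    = Qd
  Qh (suc t) = P⊆Q _ (enum-sound t)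

module _ {D : ℕ} (f : Fin D → Fin D) where

  iter-+ : ∀ a b d → iter f (a + b) d ≡ iter f a (iter f b d)
  iter-+ zero    b d = refl
  iter-+ (suc a) b d = cong f (iter-+ a b d)

  iter-periodic : ∀ {p d} → iter f p d ≡ d → ∀ n → iter f (n * p) d ≡ d
  iter-periodic per zero    = refl
  iter-periodic {p} {d} per (suc n) = begin
    iter f (p + n * p) d      ≡⟨ iter-+ p (n * p) d ⟩
    iter f p (iter f (n * p) d) ≡⟨ cong (iter f p) (iter-periodic per n) ⟩
    iter f p d                ≡⟨ per ⟩
    d                         ∎
    where open ≡-Reasoning

  iter-% : ∀ {p d} → iter f (suc p) d ≡ d → ∀ k → iter f (k % suc p) d ≡ iter f k d
  iter-% {p} {d} per k = begin
    iter f (k % suc p) d                              ≡⟨ cong (iter f (k % suc p)) (iter-periodic per (k / suc p)) ⟨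
    iter f (k % suc p) (iter f (k / suc p * suc p) d) ≡⟨ iter-+ (k % suc p) _ d ⟨
    iter f (k % suc p + k / suc p * suc p) d          ≡⟨ cong (λ j → iter f j d) (m≡m%n+[m/n]*n k (suc p)) ⟨
    iter f k d                                        ∎
    where open ≡-Reasoning

  iter-below : ∀ k d → ∃ λ k′ → k′ < D × iter f k′ d ≡ iter f k d
  iter-below k d with pigeonhole (n<1+n D) (λ i → iter f (toℕ i) d)
  ... | i , j , i<j , iterᵢ≡iterⱼ = let (k′ , k′<j , eq) = below-j k in k′ , <-≤-trans k′<j j≤D , eq
    where
    j≤D : toℕ j ≤ D
    j≤D = <⇒≤pred (Finₚ.toℕ<n j)
    below-j : ∀ k → ∃ λ k′ → k′ < toℕ j × iter f k′ d ≡ iter f k d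
    below-j zero = zero , <-≤-trans (s≤s z≤n) i<j , refl
    below-j (suc k) with below-j k
    ... | k′ , k′<j , eq with m≤n⇒m<n∨m≡n k′<j
    ... | inj₁ 1+k′<j = suc k′ , 1+k′<j , cong f eq
    ... | inj₂ 1+k′≡j = toℕ i , i<j ,
      trans iterᵢ≡iterⱼ (subst (λ x → iter f x d ≡ iter f (suc k) d) 1+k′≡j (cong f eq))

  sameOrbitᵇ-complete : ∀ {d e} → SameOrbit f d e → T (sameOrbitᵇ f d e)
  sameOrbitᵇ-complete {d} (k , eq) with iter-below k d
  ... | k′ , k′<D , eq′ = any⁺ _ (Any.map (λ { refl → fromWitness (trans eq′ eq) }) (∈-upTo⁺ k′<D))

  sameOrbitᵇ-sound : ∀ {d e} → T (sameOrbitᵇ f d e) → SameOrbit f d e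
  sameOrbitᵇ-sound t = let (k , w) = satisfied (any⁻ _ (upTo D) t) in k , toWitness w

  sameOrbit? : ∀ d e → Dec (SameOrbit f d e)
  sameOrbit? d e = map′ sameOrbitᵇ-sound sameOrbitᵇ-complete (T? (sameOrbitᵇ f d e))

  sameOrbit-refl : ∀ {d} → SameOrbit f d d
  sameOrbit-refl = 0 , refl

  sameOrbit-trans : ∀ {a b c} → SameOrbit f a b → SameOrbit f b c → SameOrbit f a c
  sameOrbit-trans {a} (k , refl) (l , refl) = l + k , iter-+ l k a

  orbit-invariant : ∀ {X : Set} (h : Fin D → X) → (∀ d → h (f d) ≡ h d) → ∀ {d e} → SameOrbit f d e → h e ≡ h d
  orbit-invariant h inv {d} (k , refl) = go k
    where
    go : ∀ k → h (iter f k d) ≡ h d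
    go zero    = refl
    go (suc k) = trans (inv _) (go k)

  LeastInOrbit : Fin D → Set
  LeastInOrbit d = ∀ e → SameOrbit f d e → toℕ d ≤ toℕ e

  isOrbitMin⇒least : ∀ {d} → T (isOrbitMin f d) → LeastInOrbit d
  isOrbitMin⇒least {d} t e (k , refl) with iter-below k d
  ... | k′ , k′<D , eq =
    subst (λ x → toℕ d ≤ toℕ x) eq (≤ᵇ⇒≤ (toℕ d) _ (All.lookup (all⁺ _ (upTo D) t) (∈-upTo⁺ k′<D)))

  orbitSize≤period : ∀ {p d} → iter f (suc p) d ≡ d → orbitSize f d ≤ suc p
  orbitSize≤period {p} {d} per = begin
    orbitSize f d                ≡⟨ length-filterᵇ-allFin (sameOrbitᵇ f d) ⟩
    count (sameOrbitᵇ f d)       ≤⟨ covering⇒count≤ (sameOrbitᵇ f d) (λ i → iter f (toℕ i) d) covers ⟩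
    suc p                        ∎
    where
    open ≤-Reasoning
    covers : ∀ e → T (sameOrbitᵇ f d e) → ∃ λ i → iter f (toℕ i) d ≡ e
    covers e t = let (k , eq) = sameOrbitᵇ-sound t; k%<p = m%n<n k (suc p) in
      fromℕ< k%<p , trans (cong (λ j → iter f j d) (Finₚ.toℕ-fromℕ< k%<p)) (trans (iter-% per k) eq)

  iterates-collide : ∀ d → ∃ λ i → ∃ λ j → i < j × j ≤ orbitSize f d × iter f i d ≡ iter f j d
  iterates-collide d =
    let (i , j , i<j , same) = pigeonhole-count (sameOrbitᵇ f d) (λ i → iter f (toℕ i) d)
                                                (λ i → sameOrbitᵇ-complete (toℕ i , refl))
        j≤size = subst (toℕ j ≤_) (sym (length-filterᵇ-allFin (sameOrbitᵇ f d))) (<⇒≤pred (Finₚ.toℕ<n j))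
    in toℕ i , toℕ j , i<j , j≤size , same

  module _ (f-inj : Injective _≡_ _≡_ f) where

    iter-injective : ∀ k {a b} → iter f k a ≡ iter f k b → a ≡ b
    iter-injective zero    eq = eq
    iter-injective (suc k) eq = iter-injective k (f-inj eq)

    iter-return : ∀ {i j d} → i < j → iter f i d ≡ iter f j d → iter f (suc (j ∸ suc i)) d ≡ d
    iter-return {i} {j} {d} i<j eq = subst (λ x → iter f x d ≡ d) (+-∸-assoc 1 i<j) (iter-injective i (begin
      iter f i (iter f (j ∸ i) d) ≡⟨ iter-+ i (j ∸ i) d ⟨
      iter f (i + (j ∸ i)) d      ≡⟨ cong (λ x → iter f x d) (m+[n∸m]≡n (<⇒≤ i<j)) ⟩
      iter f j d                  ≡⟨ eq ⟨
      iter f i d                  ∎))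
      where open ≡-Reasoning

    period : ∀ d → ∃ λ p → suc p ≤ orbitSize f d × iter f (suc p) d ≡ d
    period d = let (i , j , i<j , j≤size , eq) = iterates-collide d in
      j ∸ suc i , ≤-trans (≤-reflexive (sym (+-∸-assoc 1 i<j))) (≤-trans (m∸n≤m j i) j≤size) , iter-return i<j eq

    sameOrbit-sym : ∀ {d e} → SameOrbit f d e → SameOrbit f e d
    sameOrbit-sym {d} (k , refl) = let (p , _ , per) = period d in k * p , (begin
      iter f (k * p) (iter f k d) ≡⟨ iter-+ (k * p) k d ⟨
      iter f (k * p + k) d        ≡⟨ cong (λ x → iter f x d) (trans (+-comm (k * p) k) (sym (*-suc k p))) ⟩
      iter f (k * suc p) d        ≡⟨ iter-periodic per k ⟩
      d                           ∎)
      where open ≡-Reasoning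

    orbit-index : ∀ {c e} → SameOrbit f c e → ∃ λ j → j < orbitSize f c × iter f j c ≡ e
    orbit-index {c} (k , eq) = let (p , 1+p≤size , per) = period c in
      k % suc p , <-≤-trans (m%n<n k (suc p)) 1+p≤size , trans (iter-% per k) eq

    iter-distinct : ∀ {a b c} → a < b → b < orbitSize f c → iter f a c ≢ iter f b c
    iter-distinct {a} {b} {c} a<b b<size eq = <⇒≱ b<size (begin
      orbitSize f c    ≤⟨ orbitSize≤period (iter-return a<b eq) ⟩
      suc (b ∸ suc a)  ≡⟨ +-∸-assoc 1 a<b ⟨
      b ∸ a            ≤⟨ m∸n≤m b a ⟩
      b                ∎)
      where open ≤-Reasoning

    iter-index-injective : ∀ {a b c} → a < orbitSize f c → b < orbitSize f c → iter f a c ≡ iter f b c → a ≡ b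
    iter-index-injective {a} {b} a<size b<size eq with <-cmp a b
    ... | tri< a<b _ _ = contradiction eq (iter-distinct a<b b<size)
    ... | tri≈ _ a≡b _ = a≡b
    ... | tri> _ _ a>b = contradiction (sym eq) (iter-distinct a>b a<size)

    orbitSize≡1⇒fixed : ∀ {d e} → orbitSize f d ≡ 1 → SameOrbit f d e → d ≡ e
    orbitSize≡1⇒fixed size≡1 s with orbit-index s
    ... | zero  , _     , eq = eq
    ... | suc j , j<1 , _    = contradiction (subst (suc j <_) size≡1 j<1) λ { (s≤s ()) }

    least-unique : ∀ {d d′} → LeastInOrbit d → LeastInOrbit d′ → SameOrbit f d d′ → d ≡ d′
    least-unique least least′ s = toℕ-injective (≤-antisym (least _ s) (least′ _ (sameOrbit-sym s)))

    private
      smallest : ∀ d → ∃ λ e → ¬ ¬ SameOrbit f d e × ((j : Fin (toℕ e)) → ¬ SameOrbit f d (inject j))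
      smallest d = Finₚ.¬∀⟶∃¬-smallest D (λ e → ¬ SameOrbit f d e) (λ e → ¬? (sameOrbit? d e))
                                       (λ ¬s → ¬s d sameOrbit-refl)

    orbitMin : Fin D → Fin D
    orbitMin d = proj₁ (smallest d)

    orbitMin-sameOrbit : ∀ d → SameOrbit f d (orbitMin d)
    orbitMin-sameOrbit d = decidable-stable (sameOrbit? d (orbitMin d)) (proj₁ (proj₂ (smallest d)))

    orbitMin-least : ∀ d → LeastInOrbit (orbitMin d)
    orbitMin-least d e s = ≮⇒≥ λ e<min →
      proj₂ (proj₂ (smallest d)) (fromℕ< e<min)
        (subst (SameOrbit f d) (sym (inject-fromℕ< e<min)) (sameOrbit-trans (orbitMin-sameOrbit d) s))
      where
      inject-fromℕ< : ∀ {i e : Fin D} (e<i : toℕ e < toℕ i) → inject (fromℕ< e<i) ≡ e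
      inject-fromℕ< e<i = toℕ-injective (trans (Finₚ.toℕ-inject (fromℕ< e<i)) (Finₚ.toℕ-fromℕ< e<i))

    orbitMin-cong : ∀ {d d′} → SameOrbit f d d′ → orbitMin d ≡ orbitMin d′
    orbitMin-cong {d} {d′} s = least-unique (orbitMin-least d) (orbitMin-least d′)
      (sameOrbit-trans (sameOrbit-sym (orbitMin-sameOrbit d)) (sameOrbit-trans s (orbitMin-sameOrbit d′)))

module _ {D : ℕ} {f g : Fin D → Fin D} (f≗g : f ≗ g) where

  iter-cong : ∀ k d → iter f k d ≡ iter g k d
  iter-cong zero    d = refl
  iter-cong (suc k) d = trans (cong f (iter-cong k d)) (f≗g _)

  sameOrbit-cong : ∀ {d e} → SameOrbit f d e → SameOrbit g d e
  sameOrbit-cong {d} (k , eq) = k , trans (sym (iter-cong k d)) eq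

  orbitSize-cong : ∀ d → orbitSize f d ≡ orbitSize g d
  orbitSize-cong d = begin
    orbitSize f d            ≡⟨ length-filterᵇ-allFin (sameOrbitᵇ f d) ⟩
    count (sameOrbitᵇ f d)   ≡⟨ count-cong (λ e → cong or (map-cong (λ k → cong (λ x → ⌊ x ≟ e ⌋) (iter-cong k d))
                                                                    (upTo D))) ⟩
    count (sameOrbitᵇ g d)   ≡⟨ length-filterᵇ-allFin (sameOrbitᵇ g d) ⟨
    orbitSize g d            ∎
    where open ≡-Reasoning

  numOrbits-cong : numOrbits f ≡ numOrbits g
  numOrbits-cong = begin
    numOrbits f              ≡⟨ length-filterᵇ-allFin (isOrbitMin f) ⟩
    count (isOrbitMin f)     ≡⟨ count-cong (λ d → cong and (map-cong (λ k → cong (λ x → toℕ d ≤ᵇ toℕ x) (iter-cong k d))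
                                                                     (upTo D))) ⟩
    count (isOrbitMin g)     ≡⟨ length-filterᵇ-allFin (isOrbitMin g) ⟨
    numOrbits g              ∎
    where open ≡-Reasoning

reach-cong : ∀ {D} {σ α σ′ α′ : Fin D → Fin D} → σ ≗ σ′ → α ≗ α′ →
             ∀ {d e} → Reach σ α d e → Reach σ′ α′ d e
reach-cong σ≗ α≗ here = here
reach-cong σ≗ α≗ {d} (viaσ r) = viaσ (subst (λ x → Reach _ _ x _) (σ≗ d) (reach-cong σ≗ α≗ r))
reach-cong σ≗ α≗ {d} (viaα r) = viaα (subst (λ x → Reach _ _ x _) (α≗ d) (reach-cong σ≗ α≗ r))

φ-cong : ∀ {D} {σ α σ′ α′ : Fin D → Fin D} → σ ≗ σ′ → α ≗ α′ → σ ∘ α ≗ σ′ ∘ α′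
φ-cong {σ = σ} {α′ = α′} σ≗ α≗ d = trans (cong σ (α≗ d)) (σ≗ (α′ d))

-- Reachability is decided by the increasing stages reachesWithin k, which stabilise since each strict
-- increase adds a dart.
module _ {D : ℕ} (σ α : Fin D → Fin D) (target : Fin D) where

  reachesWithin : ℕ → Fin D → Bool
  reachesWithin zero    e = ⌊ e ≟ target ⌋
  reachesWithin (suc k) e = reachesWithin k e ∨ reachesWithin k (σ e) ∨ reachesWithin k (α e)

  private
    step⁺ : ∀ k e → T (reachesWithin k e) ⊎ T (reachesWithin k (σ e)) ⊎ T (reachesWithin k (α e)) →
            T (reachesWithin (suc k) e)
    step⁺ k e = Equivalence.from T-∨ ∘ Data.Sum.map₂ (Equivalence.from T-∨)

    step⁻ : ∀ k e → T (reachesWithin (suc k) e) →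
            T (reachesWithin k e) ⊎ T (reachesWithin k (σ e)) ⊎ T (reachesWithin k (α e))
    step⁻ k e = Data.Sum.map₂ (Equivalence.to T-∨) ∘ Equivalence.to T-∨

  within⇒reach : ∀ k e → T (reachesWithin k e) → Reach σ α e target
  within⇒reach zero    e t with refl ← toWitness t = here
  within⇒reach (suc k) e t with step⁻ k e t
  ... | inj₁ t′        = within⇒reach k e t′
  ... | inj₂ (inj₁ t′) = viaσ (within⇒reach k (σ e) t′)
  ... | inj₂ (inj₂ t′) = viaα (within⇒reach k (α e) t′)

  reach⇒within : ∀ {e} → Reach σ α e target → ∃ λ k → T (reachesWithin k e)
  reach⇒within here     = 0 , fromWitness refl
  reach⇒within (viaσ r) = let (k , t) = reach⇒within r in suc k , step⁺ k _ (inj₂ (inj₁ t))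
  reach⇒within (viaα r) = let (k , t) = reach⇒within r in suc k , step⁺ k _ (inj₂ (inj₂ t))

  Stable : ℕ → Set
  Stable k = ∀ e → T (reachesWithin (suc k) e) → T (reachesWithin k e)

  stable⇒closed : ∀ K → Stable K → ∀ k e → T (reachesWithin k e) → T (reachesWithin K e)
  stable⇒closed K stable zero e t = from-zero K t
    where
    from-zero : ∀ K → T (reachesWithin 0 e) → T (reachesWithin K e)
    from-zero zero    t = t
    from-zero (suc K) t = step⁺ K e (inj₁ (from-zero K t))
  stable⇒closed K stable (suc k) e t =
    stable e (step⁺ K e (Data.Sum.map (close e) (Data.Sum.map (close (σ e)) (close (α e))) (step⁻ k e t)))
    where
    close : ∀ x → T (reachesWithin k x) → T (reachesWithin K x)
    close = stable⇒closed K stable k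

  stable-or-growing : ∀ k → (∃ λ K → Stable K) ⊎ k < count (reachesWithin k)
  stable-or-growing zero = inj₂ (injective⇒≤count (reachesWithin 0) (λ (_ : Fin 1) → target)
                                                  (λ { {zero} {zero} _ → refl }) (λ _ → fromWitness refl))
  stable-or-growing (suc k) with stable-or-growing k
  ... | inj₁ stable = inj₁ stable
  ... | inj₂ growing with Finₚ.any? (λ e → T? (reachesWithin (suc k) e) ×-dec ¬? (T? (reachesWithin k e)))
  ... | yes (e , new , ¬old) = inj₂ (<-≤-trans (s≤s growing)
          (count-strict (reachesWithin k) (reachesWithin (suc k)) (λ e → step⁺ k e ∘ inj₁) e new ¬old))
  ... | no ¬new = inj₁ (k , λ e t → decidable-stable (T? (reachesWithin k e)) (λ ¬old → ¬new (e , t , ¬old)))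

  stable-stage : ∃ λ K → Stable K
  stable-stage with stable-or-growing D
  ... | inj₁ stable  = stable
  ... | inj₂ growing = contradiction (count≤size (reachesWithin D)) (<⇒≱ growing)

  reach? : ∀ e → Dec (Reach σ α e target)
  reach? e = let (K , stable) = stable-stage in
    map′ (within⇒reach K e) (λ r → let (k , t) = reach⇒within r in stable⇒closed K stable k e t) (T? (reachesWithin K e))

connected? : ∀ {D} (σ α : Fin D → Fin D) → Dec (∀ d d′ → Reach σ α d d′)
connected? σ α = Finₚ.all? λ d → Finₚ.all? λ d′ → reach? σ α d′ d

_≟ᶜ_ : (a b : Colour) → Dec (a ≡ b)
black  ≟ᶜ black  = yes refl
white  ≟ᶜ white  = yes refl
square ≟ᶜ square = yes refl
black  ≟ᶜ white  = no λ ()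
black  ≟ᶜ square = no λ ()
white  ≟ᶜ black  = no λ ()
white  ≟ᶜ square = no λ ()
square ≟ᶜ black  = no λ ()
square ≟ᶜ white  = no λ ()

nonBlack-nonSquare⇒white : ∀ {c} → c ≢ black → c ≢ square → c ≡ white
nonBlack-nonSquare⇒white {black}  nb _  = contradiction refl nb
nonBlack-nonSquare⇒white {white}  _  _  = refl
nonBlack-nonSquare⇒white {square} _  ns = contradiction refl ns

injection-↔⇒≤ : ∀ {X Y : Set} {m n} → Fin m ↔ X → Fin n ↔ Y → (h : X → Y) → Injective _≡_ _≡_ h → m ≤ n
injection-↔⇒≤ X Y h h-inj =
  injective⇒≤ (Injection.injective (↣-trans (↔⇒↣ X) (↣-trans (mk↣ h-inj) (↔⇒↣ (↔-sym Y)))))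

faces-bound : ∀ r n δ → + suc r ℤ.* (+ n ℤ.- + 2) ≡ + suc r ℤ.* δ → n ≤ ∣ δ ∣ + 2
faces-bound r n δ eq = begin
  ∣ + n ∣                  ≡⟨ cong ∣_∣ (ℤ-group.//-rightDividesˡ (+ 2) (+ n)) ⟨
  ∣ + n ℤ.- + 2 ℤ.+ + 2 ∣  ≡⟨ cong (λ i → ∣ i ℤ.+ + 2 ∣) (ℤₚ.*-cancelˡ-≡ (+ suc r) _ _ eq) ⟩
  ∣ δ ℤ.+ + 2 ∣            ≤⟨ ℤₚ.∣i+j∣≤∣i∣+∣j∣ δ (+ 2) ⟩
  ∣ δ ∣ + 2                ∎
  where
  open ≤-Reasoning
  module ℤ-group = AbelianGroupProperties ℤₚ.+-0-abelianGroup

darts-arith : ∀ {D V F K Q} → V * 3 ≤ D + K * 3 → V + F ≡ D / 2 + 2 → F ≤ Q → D ≤ (K + Q) * 6 + 1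
darts-arith {D} {V} {F} {K} {Q} vertices euler faces = begin
  D                        ≤⟨ D≤2E+1 ⟩
  E * 2 + 1                ≤⟨ +-monoˡ-≤ 1 (*-monoˡ-≤ 2 E≤[K+Q]*3) ⟩
  (K + Q) * 3 * 2 + 1      ≡⟨ cong (_+ 1) (*-assoc (K + Q) 3 2) ⟩
  (K + Q) * 6 + 1          ∎
  where
  open ≤-Reasoning
  open +-*-Solver
  E = D / 2
  D≤2E+1 : D ≤ E * 2 + 1
  D≤2E+1 = begin
    D                  ≡⟨ m≡m%n+[m/n]*n D 2 ⟩
    D % 2 + E * 2      ≤⟨ +-monoˡ-≤ (E * 2) (<⇒≤pred (m%n<n D 2)) ⟩
    1 + E * 2          ≡⟨ +-comm 1 (E * 2) ⟩
    E * 2 + 1          ∎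
  tripled-euler : E * 2 + suc (E + 5) ≤ E * 2 + suc ((K + Q) * 3)
  tripled-euler = begin
    E * 2 + suc (E + 5)      ≡⟨ solve 1 (λ e → e :* con 2 :+ (con 1 :+ (e :+ con 5)) := (e :+ con 2) :* con 3) refl E ⟩
    (E + 2) * 3              ≡⟨ cong (_* 3) euler ⟨
    (V + F) * 3              ≡⟨ *-distribʳ-+ 3 V F ⟩
    V * 3 + F * 3            ≤⟨ +-mono-≤ vertices (*-monoˡ-≤ 3 faces) ⟩
    D + K * 3 + Q * 3        ≤⟨ +-monoˡ-≤ (Q * 3) (+-monoˡ-≤ (K * 3) D≤2E+1) ⟩
    E * 2 + 1 + K * 3 + Q * 3 ≡⟨ solve 3 (λ e k q → e :* con 2 :+ con 1 :+ k :* con 3 :+ q :* con 3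
                                             := e :* con 2 :+ (con 1 :+ (k :+ q) :* con 3)) refl E K Q ⟩
    E * 2 + suc ((K + Q) * 3) ∎
  E≤[K+Q]*3 : E ≤ (K + Q) * 3
  E≤[K+Q]*3 = ≤-trans (m≤m+n E 5) (≤-pred (+-cancelˡ-≤ (E * 2) _ _ tripled-euler))

module _ {A : Set} {D K r : ℕ} (M : CMap A D) (adm : Admissible r M)
         (label : ∀ d → colour M d ≢ black → Fin K)
         (label-injective : ∀ {d d′} p p′ → label d p ≡ label d′ p′ → SameOrbit (σ M) d d′) where

  -- Three corners of every black vertex and three copies of every label give an injection of vertices × Fin 3.
  private
    corner : Fin D → Fin 3 → Fin D ⊎ (Fin K × Fin 3)
    corner m t with colour M m ≟ᶜ black
    ... | yes _ = inj₁ (iter (σ M) (toℕ t) m)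
    ... | no nb = inj₂ (label m nb , t)

    black-corner-injective : ∀ {m m′} (t t′ : Fin 3) → colour M m ≡ black →
                             LeastInOrbit (σ M) m → LeastInOrbit (σ M) m′ →
                             iter (σ M) (toℕ t) m ≡ iter (σ M) (toℕ t′) m′ → m ≡ m′ × t ≡ t′
    black-corner-injective {m} {m′} t t′ isBlack least least′ eq =
      m≡m′ , same-vertex (trans eq (cong (iter (σ M) (toℕ t′)) (sym m≡m′)))
      where
      m≡m′ : m ≡ m′
      m≡m′ = least-unique (σ M) (σ-inj M) least least′
        (sameOrbit-trans (σ M) (toℕ t , eq) (sameOrbit-sym (σ M) (σ-inj M) (toℕ t′ , refl)))
      below-size : ∀ (u : Fin 3) → toℕ u < orbitSize (σ M) m
      below-size u = <-≤-trans (Finₚ.toℕ<n u) (proj₁ (Admissible.black-deg adm m isBlack))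
      same-vertex : iter (σ M) (toℕ t) m ≡ iter (σ M) (toℕ t′) m → t ≡ t′
      same-vertex = toℕ-injective ∘ iter-index-injective (σ M) (σ-inj M) (below-size t) (below-size t′)

    corner-injective : ∀ {m m′} (t t′ : Fin 3) → LeastInOrbit (σ M) m → LeastInOrbit (σ M) m′ →
                       corner m t ≡ corner m′ t′ → m ≡ m′ × t ≡ t′
    corner-injective {m} {m′} t t′ least least′ eq with colour M m ≟ᶜ black | colour M m′ ≟ᶜ black
    ... | yes isBlack | yes _ = black-corner-injective t t′ isBlack least least′ (inj₁-injective eq)
    ... | no nb | no nb′ with same-label , refl ← ,-injective (inj₂-injective eq) =
      least-unique (σ M) (σ-inj M) least least′ (label-injective nb nb′ same-label) , refl
    corner-injective t t′ least least′ () | yes _ | no _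
    corner-injective t t′ least least′ () | no _ | yes _

  vertices-bound : numOrbits (σ M) * 3 ≤ D + K * 3
  vertices-bound = subst (λ v → v * 3 ≤ D + K * 3) (sym (length-filterᵇ-allFin (isOrbitMin (σ M))))
    (injection-↔⇒≤ *↔× (↔-trans +↔⊎ (↔-refl ⊎-↔ *↔×)) vertexCorner vertexCorner-injective)
    where
    open Enumeration (enumerate (isOrbitMin (σ M)))
    vertexCorner : Fin (count (isOrbitMin (σ M))) × Fin 3 → Fin D ⊎ (Fin K × Fin 3)
    vertexCorner (v , t) = corner (enum v) t
    vertexCorner-injective : Injective _≡_ _≡_ vertexCorner
    vertexCorner-injective {v , t} {v′ , t′} eq
      with m≡m′ , refl ← corner-injective t t′ (isOrbitMin⇒least (σ M) (enum-sound v))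
                                               (isOrbitMin⇒least (σ M) (enum-sound v′)) eq
      = cong (_, t) (enum-injective m≡m′)

  module _ {g : ℕ} {δ : ℤ} (genus : HasGenus M g) (degree : mapDegree r M g ≡ + suc r ℤ.* δ) where

    darts-bound : D ≤ (K + (∣ δ ∣ + 2)) * 6 + 1
    darts-bound = darts-arith {V = #V M} {K = K} vertices-bound (trans (sym (+-assoc (#V M) (#F M) (2 * g))) genus)
                              (faces-bound r (#F M + 2 * g) δ degree)

Finite : Set → Set
Finite X = FiniteUpTo X _≡_

Fin-finite : ∀ n → Finite (Fin n)
Fin-finite n = allFin n , ∈-allFin

Colour-finite : Finite Colour
Colour-finite = black ∷ white ∷ square ∷ [] , λ where
  black  → here refl
  white  → there (here refl)
  square → there (there (here refl))

⊎-finite : ∀ {X Y} → Finite X → Finite Y → Finite (X ⊎ Y)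
⊎-finite (xs , ∈xs) (ys , ∈ys) = map inj₁ xs ++ map inj₂ ys , λ where
  (inj₁ x) → ++⁺ˡ (map⁺ (Any.map (cong inj₁) (∈xs x)))
  (inj₂ y) → ++⁺ʳ (map inj₁ xs) (map⁺ (Any.map (cong inj₂) (∈ys y)))

Σ-finite : ∀ {X} {Y : X → Set} → Finite X → (∀ x → Finite (Y x)) → Finite (Σ X Y)
Σ-finite (xs , ∈xs) Y-finite = concatMap (λ x → map (x ,_) (proj₁ (Y-finite x))) xs , λ where
  (x , y) → concatMap⁺ _ (Any.map (λ { refl → map⁺ (Any.map (cong (x ,_)) (proj₂ (Y-finite x) y)) }) (∈xs x))

×-finiteUpTo : ∀ {X Y} {R : X → X → Set} {S : Y → Y → Set} →
               FiniteUpTo X R → FiniteUpTo Y S → FiniteUpTo (X × Y) (Pointwise R S)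
×-finiteUpTo (xs , ∈xs) (ys , ∈ys) = concatMap (λ x → map (x ,_) ys) xs , λ where
  (x , y) → concatMap⁺ _ (Any.map (λ x≈ → map⁺ (Any.map (x≈ ,_) (∈ys y))) (∈xs x))

Vector-finiteUpTo : ∀ {Y} → Finite Y → ∀ m → FiniteUpTo (Vector Y m) _≗_
Vector-finiteUpTo Y-finite zero = (λ ()) ∷ [] , λ _ → here λ ()
Vector-finiteUpTo (ys , ∈ys) (suc m) with Vector-finiteUpTo (ys , ∈ys) m
... | fs , ∈fs = concatMap (λ y → map (y Vector.∷_) fs) ys , λ f →
  concatMap⁺ _ (Any.map (λ { refl → map⁺ (Any.map (λ f≗ → λ { zero → refl ; (suc i) → f≗ i }) (∈fs (f ∘ suc))) })
                        (∈ys (f zero)))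

record Coding (X : Set) (_≅_ : X → X → Set) : Set₁ where
  field
    size            : X → ℕ
    bound           : ℕ
    size≤bound      : ∀ x → size x ≤ bound
    Code            : ℕ → Set
    _≈_             : ∀ {D} → Code D → Code D → Set
    codes           : ∀ D → FiniteUpTo (Code D) _≈_
    Valid           : ∀ {D} → Code D → Set
    valid?          : ∀ {D} (c : Code D) → Dec (Valid c)
    decode          : ∀ {D} (c : Code D) → Valid c → X
    encode          : (x : X) → Code (size x)
    encode-valid    : ∀ x {c} → encode x ≈ c → Valid c
    decode-encode   : ∀ x {c} → encode x ≈ c → (v : Valid c) → x ≅ decode c v

finite-by-coding : ∀ {X _≅_} → Coding X _≅_ → FiniteUpTo X _≅_
finite-by-coding {X} {_≅_} C = concatMap decodeAll (upTo (suc bound)) , covered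
  where
  open Coding C
  decodeIfValid : ∀ {D} (c : Code D) → Dec (Valid c) → List X
  decodeIfValid c (yes v) = decode c v ∷ []
  decodeIfValid c (no _)  = []
  decodeAll : ℕ → List X
  decodeAll D = concatMap (λ c → decodeIfValid c (valid? c)) (proj₁ (codes D))
  found : ∀ x {c} → encode x ≈ c → (v? : Dec (Valid c)) → Any (x ≅_) (decodeIfValid c v?)
  found x e (yes v) = here (decode-encode x e v)
  found x e (no ¬v) = contradiction (encode-valid x e) ¬v
  covered : ∀ x → Any (x ≅_) (concatMap decodeAll (upTo (suc bound)))
  covered x = concatMap⁺ decodeAll (Any.map (λ { refl → concatMap⁺ _ (Any.map (λ {c} e → found x e (valid? c))
                                                                               (proj₂ (codes (size x)) (encode x))) })
                                  (∈-upTo⁺ (s≤s (size≤bound x))))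

φ-injective : ∀ {A D} (M : CMap A D) → Injective _≡_ _≡_ (φ M)
φ-injective M {a} {b} eq = begin
  a                  ≡⟨ α-invol M a ⟨
  α M (α M a)        ≡⟨ cong (α M) (σ-inj M eq) ⟩
  α M (α M b)        ≡⟨ α-invol M b ⟩
  b                  ∎
  where open ≡-Reasoning

module CodedMaps {A Ch : Set} (_≟ᶜʰ_ : DecidableEquality Ch) (Ch-finite : Finite Ch) (interp : Ch → A)
                 (m r g : ℕ) (δ : ℤ) where

  -- σ, α, colours, a face label per dart (decoded by interp) and m distinguished darts.
  Code : ℕ → Set
  Code D = (Fin D → Fin D) × (Fin D → Fin D) × (Fin D → Colour) × (Fin D → Ch) × (Fin m → Fin D)

  _≈_ : ∀ {D} → Code D → Code D → Set
  _≈_ = Pointwise _≗_ (Pointwise _≗_ (Pointwise _≗_ (Pointwise _≗_ _≗_)))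

  codes : ∀ D → FiniteUpTo (Code D) _≈_
  codes D = ×-finiteUpTo darts (×-finiteUpTo darts (×-finiteUpTo (Vector-finiteUpTo Colour-finite D)
              (×-finiteUpTo (Vector-finiteUpTo Ch-finite D) (Vector-finiteUpTo (Fin-finite D) m))))
    where
    darts = Vector-finiteUpTo (Fin-finite D) D

  WellFormed : ∀ {D} (σ α : Fin D → Fin D) → (Fin D → Colour) → (Fin D → Ch) → Set
  WellFormed {D} σ α col face =
      (∀ a b → σ a ≡ σ b → a ≡ b)
    × (∀ d → α (α d) ≡ d)
    × (∀ d → α d ≢ d)
    × 1 ≤ D
    × (∀ d d′ → Reach σ α d d′)
    × (∀ d → col (σ d) ≡ col d)
    × (∀ d → face (σ (α d)) ≡ face d)
    × (∀ d → col d ≡ black → 3 ≤ orbitSize σ d × orbitSize σ d ≤ suc r)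
    × (∀ d d′ → col d ≡ white → col d′ ≡ white → SameOrbit (σ ∘ α) d d′ → SameOrbit σ d d′)
    × numOrbits σ + numOrbits (σ ∘ α) + 2 * g ≡ D / 2 + 2
    × + suc r ℤ.* ((+ numOrbits (σ ∘ α) ℤ.+ + (2 * g)) ℤ.- + 2) ≡ + suc r ℤ.* δ

  wellFormed? : ∀ {D} σ α col face → Dec (WellFormed {D} σ α col face)
  wellFormed? {D} σ α col face =
          Finₚ.all? (λ a → Finₚ.all? λ b → (σ a ≟ σ b) →-dec (a ≟ b))
    ×-dec Finₚ.all? (λ d → α (α d) ≟ d)
    ×-dec Finₚ.all? (λ d → ¬? (α d ≟ d))
    ×-dec 1 ≤? D
    ×-dec connected? σ α
    ×-dec Finₚ.all? (λ d → col (σ d) ≟ᶜ col d)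
    ×-dec Finₚ.all? (λ d → face (σ (α d)) ≟ᶜʰ face d)
    ×-dec Finₚ.all? (λ d → (col d ≟ᶜ black) →-dec (3 ≤? orbitSize σ d ×-dec orbitSize σ d ≤? suc r))
    ×-dec Finₚ.all? (λ d → Finₚ.all? λ d′ → (col d ≟ᶜ white) →-dec ((col d′ ≟ᶜ white) →-dec
                                          (sameOrbit? (σ ∘ α) d d′ →-dec sameOrbit? σ d d′)))
    ×-dec numOrbits σ + numOrbits (σ ∘ α) + 2 * g ≟ℕ D / 2 + 2
    ×-dec + suc r ℤ.* ((+ numOrbits (σ ∘ α) ℤ.+ + (2 * g)) ℤ.- + 2) ℤₚ.≟ + suc r ℤ.* δ

  module _ {D} {σ α : Fin D → Fin D} {col : Fin D → Colour} {face : Fin D → Ch} (w : WellFormed σ α col face) where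

    cmapOf : CMap A D
    cmapOf = let (σ-inj , α-invol , α-nofix , nonempty , conn , colour-σ , face-φ , _) = w in record
      { σ = σ ; α = α ; σ-inj = λ {a} {b} → σ-inj a b ; α-invol = α-invol ; α-nofix = α-nofix
      ; nonempty = nonempty ; conn = conn ; colour = col ; colour-σ = colour-σ
      ; dec = interp ∘ face ; dec-φ = cong interp ∘ face-φ }

    admissibleOf : Admissible r cmapOf
    admissibleOf = let (_ , _ , _ , _ , _ , _ , _ , black-deg , one-white , _) = w in
      record { black-deg = black-deg ; one-white = one-white }

    genusOf : HasGenus cmapOf g
    genusOf = let (_ , _ , _ , _ , _ , _ , _ , _ , _ , genus , _) = w in genus

    degreeOf : mapDegree r cmapOf g ≡ + suc r ℤ.* δ
    degreeOf = let (_ , _ , _ , _ , _ , _ , _ , _ , _ , _ , degree) = w in degree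

  wellFormed-of : ∀ {D} (M : CMap A D) → Admissible r M → HasGenus M g → mapDegree r M g ≡ + suc r ℤ.* δ →
                  (face : Fin D → Ch) → (∀ d → face (φ M d) ≡ face d) → WellFormed (σ M) (α M) (colour M) face
  wellFormed-of M adm genus degree face face-φ =
    (λ a b → σ-inj M) , α-invol M , α-nofix M , nonempty M , conn M , colour-σ M , face-φ
    , Admissible.black-deg adm , Admissible.one-white adm , genus , degree

  wellFormed-respects : ∀ {D} {σ α σ′ α′ : Fin D → Fin D} {col col′ face face′} →
    σ ≗ σ′ → α ≗ α′ → col ≗ col′ → face ≗ face′ →
    WellFormed σ α col face → WellFormed σ′ α′ col′ face′
  wellFormed-respects {σ = σ} {α} {σ′} {α′} {col} {face = face} σ≗ α≗ col≗ face≗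
    (σ-inj , α-invol , α-nofix , nonempty , conn , colour-σ , face-φ , black-deg , one-white , genus , degree) =
      (λ a b eq → σ-inj a b (trans (σ≗ a) (trans eq (sym (σ≗ b)))))
    , (λ d → trans (sym (trans (cong α (α≗ d)) (α≗ (α′ d)))) (α-invol d))
    , (λ d eq → α-nofix d (trans (α≗ d) eq))
    , nonempty
    , (λ d d′ → reach-cong σ≗ α≗ (conn d d′))
    , (λ d → trans (sym (trans (cong col (σ≗ d)) (col≗ (σ′ d)))) (trans (colour-σ d) (col≗ d)))
    , (λ d → trans (sym (trans (cong face (φ≗ d)) (face≗ _))) (trans (face-φ d) (face≗ d)))
    , (λ d isBlack → subst (λ s → 3 ≤ s × s ≤ suc r) (orbitSize-cong σ≗ d) (black-deg d (trans (col≗ d) isBlack)))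
    , (λ d d′ w w′ s → sameOrbit-cong σ≗ (one-white d d′ (trans (col≗ d) w) (trans (col≗ d′) w′)
                                                         (sameOrbit-cong (sym ∘ φ≗) s)))
    , trans (cong₂ (λ v f → v + f + 2 * g) (sym (numOrbits-cong σ≗)) (sym (numOrbits-cong φ≗))) genus
    , trans (cong (λ f → + suc r ℤ.* ((+ f ℤ.+ + (2 * g)) ℤ.- + 2)) (sym (numOrbits-cong φ≗))) degree
    where
    φ≗ : σ ∘ α ≗ σ′ ∘ α′
    φ≗ = φ-cong σ≗ α≗

  identity-iso : ∀ {D} (M : CMap A D) {σ′ α′ col′ face′} (w : WellFormed σ′ α′ col′ face′) →
                 σ M ≗ σ′ → α M ≗ α′ → colour M ≗ col′ → (∀ d → interp (face′ d) ≡ dec M d) →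
                 CIso M (cmapOf w)
  identity-iso M w σ≗ α≗ col≗ face-dec = record
    { π = id ; ρ = id ; ρπ = λ _ → refl ; πρ = λ _ → refl ; πσ = σ≗ ; πα = α≗
    ; πcol = sym ∘ col≗ ; πdec = face-dec }

  module FaceLabelling {D} (M : CMap A D) (pick : Fin D → Ch) (pick-dec : ∀ d → interp (pick d) ≡ dec M d) where

    -- Labels must be constant on faces, so they are read off at the least dart of each face.
    faceRep : Fin D → Fin D
    faceRep = orbitMin (φ M) (φ-injective M)

    faceRep-sameOrbit : ∀ d → SameOrbit (φ M) d (faceRep d)
    faceRep-sameOrbit = orbitMin-sameOrbit (φ M) (φ-injective M)

    faceLabel : Fin D → Ch
    faceLabel = pick ∘ faceRep

    faceLabel-φ : ∀ d → faceLabel (φ M d) ≡ faceLabel d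
    faceLabel-φ d = cong pick (sym (orbitMin-cong (φ M) (φ-injective M) (1 , refl)))

    faceLabel-dec : ∀ d → interp (faceLabel d) ≡ dec M d
    faceLabel-dec d = trans (pick-dec (faceRep d)) (orbit-invariant (φ M) (dec M) (dec-φ M) (faceRep-sameOrbit d))

module FFamily (A : Set) (r N : ℕ) (λs : Fin N → A) (g : ℕ) (δ : ℤ) (n : ℕ) (z : Fin n → A) where

  interp : Fin n ⊎ Fin N → A
  interp = [ z , λs ]′

  markOf : Fin n ⊎ Fin N → Maybe (Fin n)
  markOf = [ just , (λ _ → nothing) ]′

  markOf-just : ∀ {c i} → markOf c ≡ just i → c ≡ inj₁ i
  markOf-just {inj₁ _} refl = refl

  open CodedMaps (Sumₚ.≡-dec _≟_ _≟_) (⊎-finite (Fin-finite n) (Fin-finite N)) interp 0 r g δ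

  MarkedFaces : ∀ {D} → Code D → Set
  MarkedFaces (σ , α , col , face , _) =
      (∀ d → col d ≡ black)
    × (∀ i → ∃ λ d → face d ≡ inj₁ i)
    × (∀ i d d′ → face d ≡ inj₁ i → face d′ ≡ inj₁ i → SameOrbit (σ ∘ α) d d′)

  Valid : ∀ {D} → Code D → Set
  Valid c@(σ , α , col , face , _) = WellFormed σ α col face × MarkedFaces c

  valid? : ∀ {D} (c : Code D) → Dec (Valid c)
  valid? c@(σ , α , col , face , _) =
          wellFormed? σ α col face
    ×-dec Finₚ.all? (λ d → col d ≟ᶜ black)
    ×-dec Finₚ.all? (λ i → Finₚ.any? λ d → face≟ d i)
    ×-dec Finₚ.all? (λ i → Finₚ.all? λ d → Finₚ.all? λ d′ →
                      face≟ d i →-dec (face≟ d′ i →-dec sameOrbit? (σ ∘ α) d d′))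
    where
    face≟ : ∀ d i → Dec (face d ≡ inj₁ i)
    face≟ d i = Sumₚ.≡-dec _≟_ _≟_ (face d) (inj₁ i)

  decode : ∀ {D} (c : Code D) → Valid c → FMap A r N λs g δ n z
  decode (σ , α , _ , face , _) (w , allBlack , used , one) =
    record
      { D = _ ; M = cmapOf w ; adm = admissibleOf w ; genus = genusOf w ; degree = degreeOf w
      ; allBlack = allBlack ; label = markOf ∘ face ; label-φ = cong markOf ∘ face-φ
      ; label-used = λ i → let (d , eq) = used i in d , cong markOf eq
      ; label-one = λ i d d′ eq eq′ → one i d d′ (markOf-just {face d} eq) (markOf-just {face d′} eq′)
      ; dec-marked = λ i d eq → cong interp (markOf-just {face d} eq)
      ; dec-unmarked = unmarked }
    where
    face-φ : ∀ d → face (σ (α d)) ≡ face d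
    face-φ = let (_ , _ , _ , _ , _ , _ , face-φ , _) = w in face-φ
    unmarked : ∀ d → markOf (face d) ≡ nothing → InΛ λs (interp (face d))
    unmarked d = unmarked′ (face d)
      where
      unmarked′ : ∀ c → markOf c ≡ nothing → InΛ λs (interp c)
      unmarked′ (inj₂ j) _ = j , refl

  module Encoding (x : FMap A r N λs g δ n z) where
    open FMap x

    pickFrom : ∀ e l → label e ≡ l → Fin n ⊎ Fin N
    pickFrom e (just i) _  = inj₁ i
    pickFrom e nothing  eq = inj₂ (proj₁ (dec-unmarked e eq))

    pick : Fin D → Fin n ⊎ Fin N
    pick e = pickFrom e (label e) refl

    pick-dec : ∀ e → interp (pick e) ≡ dec M e
    pick-dec e = go (label e) refl
      where
      go : ∀ l (eq : label e ≡ l) → interp (pickFrom e l eq) ≡ dec M e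
      go (just i) eq = sym (dec-marked i e eq)
      go nothing  eq = sym (proj₂ (dec-unmarked e eq))

    markOf-pick : ∀ e → markOf (pick e) ≡ label e
    markOf-pick e = go (label e) refl
      where
      go : ∀ l (eq : label e ≡ l) → markOf (pickFrom e l eq) ≡ l
      go (just i) _ = refl
      go nothing  _ = refl

    open FaceLabelling M pick pick-dec

    markOf-faceLabel : ∀ d → markOf (faceLabel d) ≡ label d
    markOf-faceLabel d = trans (markOf-pick (faceRep d)) (orbit-invariant (φ M) label label-φ (faceRep-sameOrbit d))

    code : Code D
    code = σ M , α M , colour M , faceLabel , λ ()

    encode-valid : ∀ {c} → code ≈ c → Valid c
    encode-valid (σ≗ , α≗ , col≗ , face≗ , _) =
        wellFormed-respects σ≗ α≗ col≗ face≗ (wellFormed-of M adm genus degree faceLabel faceLabel-φ)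
      , (λ d → trans (sym (col≗ d)) (allBlack d))
      , (λ i → let (d , eq) = label-used i in d , trans (sym (face≗ d)) (marked eq))
      , (λ i d d′ eq eq′ → sameOrbit-cong (φ-cong σ≗ α≗)
                             (label-one i d d′ (unmark (face≗ d) eq) (unmark (face≗ d′) eq′)))
      where
      marked : ∀ {d i} → label d ≡ just i → faceLabel d ≡ inj₁ i
      marked {d} eq = markOf-just (trans (markOf-faceLabel d) eq)
      unmark : ∀ {d i c} → faceLabel d ≡ c → c ≡ inj₁ i → label d ≡ just i
      unmark {d} face≡ refl = trans (sym (markOf-faceLabel d)) (cong markOf face≡)

    decode-encode : ∀ {c} (eq : code ≈ c) (v : Valid c) → FIso A r N λs g δ x (decode c v)
    decode-encode (σ≗ , α≗ , col≗ , face≗ , _) (w , _) =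
        identity-iso M w σ≗ α≗ col≗ (λ d → trans (cong interp (sym (face≗ d))) (faceLabel-dec d))
      , λ d → trans (cong markOf (sym (face≗ d))) (markOf-faceLabel d)

    size-bound : D ≤ (0 + (∣ δ ∣ + 2)) * 6 + 1
    size-bound = darts-bound {K = 0} M adm (λ d nb → contradiction (allBlack d) nb) (λ {d} nb _ _ → contradiction (allBlack d) nb)
                             {g = g} genus degree

  coding : Coding (FMap A r N λs g δ n z) (FIso A r N λs g δ)
  coding = record
    { size = FMap.D ; bound = (0 + (∣ δ ∣ + 2)) * 6 + 1 ; size≤bound = Encoding.size-bound
    ; Code = Code ; _≈_ = _≈_ ; codes = codes ; Valid = Valid ; valid? = valid? ; decode = decode
    ; encode = Encoding.code ; encode-valid = Encoding.encode-valid ; decode-encode = Encoding.decode-encode }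

module LeafMaps (A : Set) (r N : ℕ) (λs : Fin N → A) (g : ℕ) (δ : ℤ) (n : ℕ) (z : Fin n → A) where

  interp : Fin n ⊎ Fin N → A
  interp = [ z , λs ]′

  open CodedMaps (Sumₚ.≡-dec _≟_ _≟_) (⊎-finite (Fin-finite n) (Fin-finite N)) interp n r g δ public

  WhiteLeaves : ∀ {D} → Code D → Set
  WhiteLeaves (σ , α , col , face , wd) =
      (∀ i j → wd i ≡ wd j → i ≡ j)
    × (∀ i → col (wd i) ≡ white)
    × (∀ i → orbitSize σ (wd i) ≡ 1)
    × (∀ d → col d ≡ white → ∃ λ i → d ≡ wd i)
    × (∀ i → face (wd i) ≡ inj₁ i)
    × (∀ d i → face d ≡ inj₁ i → SameOrbit (σ ∘ α) d (wd i))

  whiteLeaves? : ∀ {D} (c : Code D) → Dec (WhiteLeaves c)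
  whiteLeaves? (σ , α , col , face , wd) =
          Finₚ.all? (λ i → Finₚ.all? λ j → (wd i ≟ wd j) →-dec (i ≟ j))
    ×-dec Finₚ.all? (λ i → col (wd i) ≟ᶜ white)
    ×-dec Finₚ.all? (λ i → orbitSize σ (wd i) ≟ℕ 1)
    ×-dec Finₚ.all? (λ d → (col d ≟ᶜ white) →-dec Finₚ.any? λ i → d ≟ wd i)
    ×-dec Finₚ.all? (λ i → Sumₚ.≡-dec _≟_ _≟_ (face (wd i)) (inj₁ i))
    ×-dec Finₚ.all? (λ d → Finₚ.all? λ i →
                      Sumₚ.≡-dec _≟_ _≟_ (face d) (inj₁ i) →-dec sameOrbit? (σ ∘ α) d (wd i))

  whiteLeaves-respects : ∀ {D} {c c′ : Code D} → c ≈ c′ → WhiteLeaves c → WhiteLeaves c′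
  whiteLeaves-respects {c = σ , α , col , face , _} {σ′ , α′ , _ , _ , _} (σ≗ , α≗ , col≗ , face≗ , wd≗)
    (wd-inj , wd-white , wd-deg , white-labelled , marked , unmarked) =
      (λ i j eq → wd-inj i j (trans (wd≗ i) (trans eq (sym (wd≗ j)))))
    , (λ i → trans (sym (trans (cong col (wd≗ i)) (col≗ _))) (wd-white i))
    , (λ i → trans (sym (trans (cong (orbitSize σ) (wd≗ i)) (orbitSize-cong σ≗ _))) (wd-deg i))
    , (λ d isWhite → let (i , eq) = white-labelled d (trans (col≗ d) isWhite) in i , trans eq (wd≗ i))
    , (λ i → trans (sym (trans (cong face (wd≗ i)) (face≗ _))) (marked i))
    , (λ d i eq → subst (SameOrbit (σ′ ∘ α′) d) (wd≗ i)
                        (sameOrbit-cong (φ-cong σ≗ α≗) (unmarked d i (trans (face≗ d) eq))))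

  unmarked-inΛ : ∀ {D} (c : Code D) → WhiteLeaves c → let (σ , α , _ , face , wd) = c in
                 ∀ d → (∀ i → ¬ SameOrbit (σ ∘ α) d (wd i)) → InΛ λs (interp (face d))
  unmarked-inΛ (_ , _ , _ , face , _) (_ , _ , _ , _ , _ , unmarked) d ¬marked with face d in eq
  ... | inj₁ i = contradiction (unmarked d i eq) (¬marked i)
  ... | inj₂ j = j , refl

  module LeafFaces {D} (M : CMap A D) (adm : Admissible r M) (wdart : Fin n → Fin D)
                   (wdart-injective : Injective _≡_ _≡_ wdart) (wdart-white : ∀ i → colour M (wdart i) ≡ white)
                   (wdart-deg : ∀ i → vdeg M (wdart i) ≡ 1)
                   (white-labelled : ∀ d → colour M d ≡ white → ∃ λ i → d ≡ wdart i)
                   (dec-marked : ∀ i → dec M (wdart i) ≡ z i)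
                   (dec-unmarked : ∀ d → (∀ i → ¬ SameOrbit (φ M) d (wdart i)) → InΛ λs (dec M d)) where

    pick : Fin D → Fin n ⊎ Fin N
    pick e with Finₚ.any? (λ i → sameOrbit? (φ M) e (wdart i))
    ... | yes (i , _)  = inj₁ i
    ... | no ¬marked = inj₂ (proj₁ (dec-unmarked e (λ i s → ¬marked (i , s))))

    pick-dec : ∀ e → interp (pick e) ≡ dec M e
    pick-dec e with Finₚ.any? (λ i → sameOrbit? (φ M) e (wdart i))
    ... | yes (i , s)  = trans (sym (dec-marked i)) (orbit-invariant (φ M) (dec M) (dec-φ M) s)
    ... | no ¬marked = sym (proj₂ (dec-unmarked e (λ i s → ¬marked (i , s))))

    open FaceLabelling M pick pick-dec public

    -- Two white leaves in one face share their vertex (one-white), so they coincide.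
    faceLabel-marked : ∀ i → faceLabel (wdart i) ≡ inj₁ i
    faceLabel-marked i with Finₚ.any? (λ i′ → sameOrbit? (φ M) (faceRep (wdart i)) (wdart i′))
    ... | yes (i′ , s) = cong inj₁ (sym (wdart-injective (orbitSize≡1⇒fixed (σ M) (σ-inj M) (wdart-deg i)
            (Admissible.one-white adm _ _ (wdart-white i) (wdart-white i′)
               (sameOrbit-trans (φ M) (faceRep-sameOrbit (wdart i)) s)))))
    ... | no ¬marked = contradiction (i , sameOrbit-sym (φ M) (φ-injective M) (faceRep-sameOrbit (wdart i))) ¬marked

    faceLabel-unmarked : ∀ d i → faceLabel d ≡ inj₁ i → SameOrbit (φ M) d (wdart i)
    faceLabel-unmarked d i eq with Finₚ.any? (λ i′ → sameOrbit? (φ M) (faceRep d) (wdart i′))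
    faceLabel-unmarked d i refl | yes (_ , s) = sameOrbit-trans (φ M) (faceRep-sameOrbit d) s

    code : Code D
    code = σ M , α M , colour M , faceLabel , wdart

    whiteLeaves : WhiteLeaves code
    whiteLeaves = (λ i j → wdart-injective) , wdart-white , wdart-deg , white-labelled , faceLabel-marked , faceLabel-unmarked

module WFamily (A : Set) (r N : ℕ) (λs : Fin N → A) (g : ℕ) (δ : ℤ) (n : ℕ) (z : Fin n → A) where
  open LeafMaps A r N λs g δ n z

  Valid : ∀ {D} → Code D → Set
  Valid c@(σ , α , col , face , _) = WellFormed σ α col face × (∀ d → col d ≢ square) × WhiteLeaves c

  valid? : ∀ {D} (c : Code D) → Dec (Valid c)
  valid? c@(σ , α , col , face , _) =
    wellFormed? σ α col face ×-dec Finₚ.all? (λ d → ¬? (col d ≟ᶜ square)) ×-dec whiteLeaves? c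

  decode : ∀ {D} (c : Code D) → Valid c → WMap A r N λs g δ n z
  decode c@(_ , _ , _ , _ , wd) (w , noSquare , leaves@(wd-inj , wd-white , wd-deg , white-labelled , marked , _)) =
    record
      { D = _ ; M = cmapOf w ; adm = admissibleOf w ; genus = genusOf w ; degree = degreeOf w
      ; noSquare = noSquare ; wdart = wd ; wdart-inj = λ {i} {j} → wd-inj i j ; wdart-white = wd-white
      ; wdart-deg = wd-deg ; white-labelled = white-labelled ; dec-marked = cong interp ∘ marked
      ; dec-unmarked = unmarked-inΛ c leaves }

  module Encoding (x : WMap A r N λs g δ n z) where
    open WMap x
    open LeafFaces M adm wdart wdart-inj wdart-white wdart-deg white-labelled dec-marked dec-unmarked public

    encode-valid : ∀ {c} → code ≈ c → Valid c
    encode-valid eq@(σ≗ , α≗ , col≗ , face≗ , _) =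
        wellFormed-respects σ≗ α≗ col≗ face≗ (wellFormed-of M adm genus degree faceLabel faceLabel-φ)
      , (λ d isSquare → noSquare d (trans (col≗ d) isSquare))
      , whiteLeaves-respects eq whiteLeaves

    decode-encode : ∀ {c} (eq : code ≈ c) (v : Valid c) → WIso A r N λs g δ x (decode c v)
    decode-encode (σ≗ , α≗ , col≗ , face≗ , wd≗) (w , _) =
      identity-iso M w σ≗ α≗ col≗ (λ d → trans (cong interp (sym (face≗ d))) (faceLabel-dec d)) , wd≗

    size-bound : D ≤ (n + (∣ δ ∣ + 2)) * 6 + 1
    size-bound = darts-bound M adm label label-injective {g = g} genus degree
      where
      isWhite : ∀ {d} → colour M d ≢ black → colour M d ≡ white
      isWhite {d} nb = nonBlack-nonSquare⇒white nb (noSquare d)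
      label : ∀ d → colour M d ≢ black → Fin n
      label d nb = proj₁ (white-labelled d (isWhite nb))
      label-injective : ∀ {d d′} p p′ → label d p ≡ label d′ p′ → SameOrbit (σ M) d d′
      label-injective {d} {d′} p p′ eq = 0 , (begin
        d                    ≡⟨ proj₂ (white-labelled d (isWhite p)) ⟩
        wdart (label d p)    ≡⟨ cong wdart eq ⟩
        wdart (label d′ p′)  ≡⟨ proj₂ (white-labelled d′ (isWhite p′)) ⟨
        d′                   ∎)
        where open ≡-Reasoning

  coding : Coding (WMap A r N λs g δ n z) (WIso A r N λs g δ)
  coding = record
    { size = WMap.D ; bound = (n + (∣ δ ∣ + 2)) * 6 + 1 ; size≤bound = Encoding.size-bound
    ; Code = Code ; _≈_ = _≈_ ; codes = codes ; Valid = Valid ; valid? = valid? ; decode = decode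
    ; encode = Encoding.code ; encode-valid = Encoding.encode-valid ; decode-encode = Encoding.decode-encode }

module UFamily (A : Set) (r N : ℕ) (λs : Fin N → A) (g : ℕ) (δ : ℤ) (n : ℕ) (0<n : 0 < n) (u : A) (z : Fin n → A) where
  open LeafMaps A r N λs g δ n z

  first : Fin n
  first = fromℕ< 0<n

  SquareAtFirst : ∀ {D} → Code D → Set
  SquareAtFirst (σ , α , col , _ , wd) =
    col (α (wd first)) ≡ square × (∀ d → col d ≡ square → SameOrbit σ (α (wd first)) d)

  Valid : ∀ {D} → Code D → Set
  Valid c@(σ , α , col , face , _) = WellFormed σ α col face × WhiteLeaves c × SquareAtFirst c

  valid? : ∀ {D} (c : Code D) → Dec (Valid c)
  valid? c@(σ , α , col , face , wd) =
    wellFormed? σ α col face ×-dec whiteLeaves? c ×-dec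
    (col (α (wd first)) ≟ᶜ square ×-dec Finₚ.all? (λ d → (col d ≟ᶜ square) →-dec sameOrbit? σ (α (wd first)) d))

  decode : ∀ {D} (c : Code D) → Valid c → UMap A r N λs g δ n 0<n u z
  decode c@(_ , _ , _ , _ , wd)
         (w , leaves@(wd-inj , wd-white , wd-deg , white-labelled , marked , _) , square-at-first , square-unique) =
    record
      { D = _ ; M = cmapOf w ; adm = admissibleOf w ; genus = genusOf w ; degree = degreeOf w
      ; wdart = wd ; wdart-inj = λ {i} {j} → wd-inj i j ; wdart-white = wd-white ; wdart-deg = wd-deg
      ; white-labelled = white-labelled ; square-at-first = square-at-first ; square-unique = square-unique
      ; dec-marked = cong interp ∘ marked ; dec-unmarked = unmarked-inΛ c leaves }

  module Encoding (x : UMap A r N λs g δ n 0<n u z) where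
    open UMap x
    open LeafFaces M adm wdart wdart-inj wdart-white wdart-deg white-labelled dec-marked dec-unmarked public

    encode-valid : ∀ {c} → code ≈ c → Valid c
    encode-valid eq@(σ≗ , α≗ , col≗ , face≗ , wd≗) =
        wellFormed-respects σ≗ α≗ col≗ face≗ (wellFormed-of M adm genus degree faceLabel faceLabel-φ)
      , whiteLeaves-respects eq whiteLeaves
      , trans (sym (trans (cong (colour M) squareDart≗) (col≗ _))) square-at-first
      , (λ d isSquare → subst (λ s → SameOrbit _ s d) squareDart≗
                              (sameOrbit-cong σ≗ (square-unique d (trans (col≗ d) isSquare))))
      where
      squareDart≗ : α M (wdart first) ≡ _
      squareDart≗ = trans (cong (α M) (wd≗ first)) (α≗ _)

    decode-encode : ∀ {c} (eq : code ≈ c) (v : Valid c) → UIso A r N λs g δ x (decode c v)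
    decode-encode (σ≗ , α≗ , col≗ , face≗ , wd≗) (w , _) =
      identity-iso M w σ≗ α≗ col≗ (λ d → trans (cong interp (sym (face≗ d))) (faceLabel-dec d)) , wd≗

    size-bound : D ≤ (suc n + (∣ δ ∣ + 2)) * 6 + 1
    size-bound = darts-bound M adm label (label-injective _ _ refl refl) {g = g} genus degree
      where
      labelOf : ∀ d c → colour M d ≡ c → c ≢ black → Fin (suc n)
      labelOf d black  _       nb = contradiction refl nb
      labelOf d white  isWhite _  = suc (proj₁ (white-labelled d isWhite))
      labelOf d square _       _  = zero
      label : ∀ d → colour M d ≢ black → Fin (suc n)
      label d = labelOf d (colour M d) refl
      label-injective : ∀ {d d′} c c′ (eq : colour M d ≡ c) (eq′ : colour M d′ ≡ c′) nb nb′ →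
                        labelOf d c eq nb ≡ labelOf d′ c′ eq′ nb′ → SameOrbit (σ M) d d′
      label-injective black  _      _ _ nb _   _ = contradiction refl nb
      label-injective _      black  _ _ _  nb′ _ = contradiction refl nb′
      label-injective {d} {d′} white white isWhite isWhite′ _ _ same = 0 , (begin
        d                                        ≡⟨ proj₂ (white-labelled d isWhite) ⟩
        wdart (proj₁ (white-labelled d isWhite))  ≡⟨ cong wdart (Finₚ.suc-injective same) ⟩
        wdart (proj₁ (white-labelled d′ isWhite′)) ≡⟨ proj₂ (white-labelled d′ isWhite′) ⟨
        d′                                       ∎)
        where open ≡-Reasoning
      label-injective {d} {d′} square square isSquare isSquare′ _ _ _ =
        sameOrbit-trans (σ M) (sameOrbit-sym (σ M) (σ-inj M) (square-unique d isSquare)) (square-unique d′ isSquare′)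

  coding : Coding (UMap A r N λs g δ n 0<n u z) (UIso A r N λs g δ)
  coding = record
    { size = UMap.D ; bound = (suc n + (∣ δ ∣ + 2)) * 6 + 1 ; size≤bound = Encoding.size-bound
    ; Code = Code ; _≈_ = _≈_ ; codes = codes ; Valid = Valid ; valid? = valid? ; decode = decode
    ; encode = Encoding.code ; encode-valid = Encoding.encode-valid ; decode-encode = Encoding.decode-encode }

module SFamily (A : Set) (r N : ℕ) (λs : Fin N → A) (g : ℕ) (δ : ℤ) (n : ℕ) (k : Fin n → ℕ)
               (S : (i : Fin n) → Fin (k i) → A) where

  Corner : Set
  Corner = Σ (Fin n) (Fin ∘ k)

  _≟corner_ : DecidableEquality (Corner ⊎ Fin N)
  _≟corner_ = Sumₚ.≡-dec (Productₚ.≡-dec _≟_ _≟_) _≟_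

  interp : Corner ⊎ Fin N → A
  interp = [ uncurry S , λs ]′

  open CodedMaps _≟corner_ (⊎-finite (Σ-finite (Fin-finite n) (Fin-finite ∘ k)) (Fin-finite N)) interp n r g δ

  Ciliated : ∀ {D} → Code D → Set
  Ciliated (σ , α , col , face , cil) =
      (∀ d → col d ≢ square)
    × (∀ i → col (cil i) ≡ white)
    × (∀ i i′ → SameOrbit σ (cil i) (cil i′) → i ≡ i′)
    × (∀ d → col d ≡ white → ∃ λ i → SameOrbit σ (cil i) d)
    × (∀ i → orbitSize σ (cil i) ≡ k i)
    × (∀ d d′ → col d ≡ white → SameOrbit σ d d′ → SameOrbit (σ ∘ α) d d′ → d ≡ d′)
    × (∀ i (j : Fin (k i)) → face (iter σ (toℕ j) (cil i)) ≡ inj₁ (i , j))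
    × (∀ d i (j : Fin (k i)) → face d ≡ inj₁ (i , j) → SameOrbit (σ ∘ α) d (iter σ (toℕ j) (cil i)))

  Valid : ∀ {D} → Code D → Set
  Valid c@(σ , α , col , face , _) = WellFormed σ α col face × Ciliated c

  valid? : ∀ {D} (c : Code D) → Dec (Valid c)
  valid? c@(σ , α , col , face , cil) =
          wellFormed? σ α col face
    ×-dec Finₚ.all? (λ d → ¬? (col d ≟ᶜ square))
    ×-dec Finₚ.all? (λ i → col (cil i) ≟ᶜ white)
    ×-dec Finₚ.all? (λ i → Finₚ.all? λ i′ → sameOrbit? σ (cil i) (cil i′) →-dec (i ≟ i′))
    ×-dec Finₚ.all? (λ d → (col d ≟ᶜ white) →-dec Finₚ.any? λ i → sameOrbit? σ (cil i) d)
    ×-dec Finₚ.all? (λ i → orbitSize σ (cil i) ≟ℕ k i)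
    ×-dec Finₚ.all? (λ d → Finₚ.all? λ d′ → (col d ≟ᶜ white) →-dec
                      (sameOrbit? σ d d′ →-dec (sameOrbit? (σ ∘ α) d d′ →-dec (d ≟ d′))))
    ×-dec Finₚ.all? (λ i → Finₚ.all? λ j → face (iter σ (toℕ j) (cil i)) ≟corner inj₁ (i , j))
    ×-dec Finₚ.all? (λ d → Finₚ.all? λ i → Finₚ.all? λ j →
                      (face d ≟corner inj₁ (i , j)) →-dec sameOrbit? (σ ∘ α) d (iter σ (toℕ j) (cil i)))

  ciliated-respects : ∀ {D} {c c′ : Code D} → c ≈ c′ → Ciliated c → Ciliated c′
  ciliated-respects {c = σ , α , col , face , cil} {σ′ , α′ , _ , _ , cil′} (σ≗ , α≗ , col≗ , face≗ , cil≗)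
    (noSquare , cil-white , cil-distinct , white-labelled , cil-deg , star , marked , unmarked) =
      (λ d isSquare → noSquare d (trans (col≗ d) isSquare))
    , (λ i → trans (sym (trans (cong col (cil≗ i)) (col≗ _))) (cil-white i))
    , (λ i i′ s → cil-distinct i i′
                    (subst₂ (SameOrbit σ) (sym (cil≗ i)) (sym (cil≗ i′)) (sameOrbit-cong (sym ∘ σ≗) s)))
    , (λ d isWhite → let (i , s) = white-labelled d (trans (col≗ d) isWhite) in
                     i , subst (λ c → SameOrbit σ′ c d) (cil≗ i) (sameOrbit-cong σ≗ s))
    , (λ i → trans (sym (trans (cong (orbitSize σ) (cil≗ i)) (orbitSize-cong σ≗ _))) (cil-deg i))
    , (λ d d′ isWhite s s′ → star d d′ (trans (col≗ d) isWhite) (sameOrbit-cong (sym ∘ σ≗) s)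
                                      (sameOrbit-cong (sym ∘ φ-cong σ≗ α≗) s′))
    , (λ i j → trans (sym (trans (cong face (corner≗ i j)) (face≗ _))) (marked i j))
    , (λ d i j eq → subst (SameOrbit (σ′ ∘ α′) d) (corner≗ i j)
                          (sameOrbit-cong (φ-cong σ≗ α≗) (unmarked d i j (trans (face≗ d) eq))))
    where
    corner≗ : ∀ i (j : Fin (k i)) → iter σ (toℕ j) (cil i) ≡ iter σ′ (toℕ j) (cil′ i)
    corner≗ i j = trans (iter-cong σ≗ (toℕ j) (cil i)) (cong (iter σ′ (toℕ j)) (cil≗ i))

  decode : ∀ {D} (c : Code D) → Valid c → SMap A r N λs g δ n k S
  decode (σ , α , col , face , cil)
         (w , noSquare , cil-white , cil-distinct , white-labelled , cil-deg , star , marked , unmarked) =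
    record
      { D = _ ; M = cmapOf w ; adm = admissibleOf w ; genus = genusOf w ; degree = degreeOf w
      ; noSquare = noSquare ; cilium = cil ; cilium-white = cil-white ; cilium-distinct = cil-distinct
      ; white-labelled = white-labelled ; cilium-deg = cil-deg ; star = star
      ; dec-marked = λ i j → cong interp (marked i j) ; dec-unmarked = inΛ }
    where
    col-σ : ∀ d → col (σ d) ≡ col d
    col-σ = let (_ , _ , _ , _ , _ , col-σ , _) = w in col-σ
    inΛ : ∀ d → (∀ d′ → col d′ ≡ white → ¬ SameOrbit (σ ∘ α) d d′) → InΛ λs (interp (face d))
    inΛ d ¬marked with face d in eq
    ... | inj₁ (i , j) = contradiction (unmarked d i j eq)
                           (¬marked _ (trans (orbit-invariant σ col col-σ (toℕ j , refl)) (cil-white i)))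
    ... | inj₂ j = j , refl

  module Encoding (x : SMap A r N λs g δ n k S) where
    open SMap x

    corner : (i : Fin n) → Fin (k i) → Fin D
    corner i j = iter (σ M) (toℕ j) (cilium i)

    corner-white : ∀ i j → colour M (corner i j) ≡ white
    corner-white i j = trans (orbit-invariant (σ M) (colour M) (colour-σ M) (toℕ j , refl)) (cilium-white i)

    corner-injective : ∀ i {j j′ : Fin (k i)} → corner i j ≡ corner i j′ → j ≡ j′
    corner-injective i {j} {j′} = toℕ-injective ∘ iter-index-injective (σ M) (σ-inj M) (below-deg j) (below-deg j′)
      where
      below-deg : ∀ (u : Fin (k i)) → toℕ u < orbitSize (σ M) (cilium i)
      below-deg u = subst (toℕ u <_) (sym (cilium-deg i)) (Finₚ.toℕ<n u)

    unmarked-face : ∀ e → ¬ (∃ λ i → ∃ λ j → SameOrbit (φ M) e (corner i j)) →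
                    ∀ d′ → colour M d′ ≡ white → ¬ SameOrbit (φ M) e d′
    unmarked-face e ¬corner d′ isWhite s =
      let (i , around) = white-labelled d′ isWhite
          (j , j<deg , eq) = orbit-index (σ M) (σ-inj M) around
          j<k = subst (j <_) (cilium-deg i) j<deg
          corner≡d′ = trans (cong (λ t → iter (σ M) t (cilium i)) (Finₚ.toℕ-fromℕ< j<k)) eq
      in ¬corner (i , fromℕ< j<k , subst (SameOrbit (φ M) e) (sym corner≡d′) s)

    pick : Fin D → Corner ⊎ Fin N
    pick e with Finₚ.any? (λ i → Finₚ.any? λ j → sameOrbit? (φ M) e (corner i j))
    ... | yes (i , j , _) = inj₁ (i , j)
    ... | no ¬corner      = inj₂ (proj₁ (dec-unmarked e (unmarked-face e ¬corner)))

    pick-dec : ∀ e → interp (pick e) ≡ dec M e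
    pick-dec e with Finₚ.any? (λ i → Finₚ.any? λ j → sameOrbit? (φ M) e (corner i j))
    ... | yes (i , j , s) = trans (sym (dec-marked i j)) (orbit-invariant (φ M) (dec M) (dec-φ M) s)
    ... | no ¬corner      = sym (proj₂ (dec-unmarked e (unmarked-face e ¬corner)))

    open FaceLabelling M pick pick-dec

    corner-sameVertex : ∀ {i i′} j j′ → SameOrbit (φ M) (corner i j) (corner i′ j′) →
                        SameOrbit (σ M) (corner i j) (corner i′ j′)
    corner-sameVertex {i} {i′} j j′ = Admissible.one-white adm _ _ (corner-white i j) (corner-white i′ j′)

    -- one-white puts both corners at one vertex, and star then identifies them.
    corners-in-one-face : ∀ {i i′} j j′ → SameOrbit (φ M) (corner i j) (corner i′ j′) →
                          _≡_ {A = Corner} (i , j) (i′ , j′)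
    corners-in-one-face {i} {i′} j j′ sameFace
      with refl ← cilium-distinct i i′ (sameOrbit-trans (σ M) (toℕ j , refl)
                    (sameOrbit-trans (σ M) (corner-sameVertex j j′ sameFace) (sameOrbit-sym (σ M) (σ-inj M) (toℕ j′ , refl))))
      = cong (i ,_) (corner-injective i (star _ _ (corner-white i j) (corner-sameVertex j j′ sameFace) sameFace))

    faceLabel-marked : ∀ i j → faceLabel (corner i j) ≡ inj₁ (i , j)
    faceLabel-marked i j
      with Finₚ.any? (λ i′ → Finₚ.any? λ j′ → sameOrbit? (φ M) (faceRep (corner i j)) (corner i′ j′))
    ... | yes (i′ , j′ , s) =
      cong inj₁ (sym (corners-in-one-face j j′ (sameOrbit-trans (φ M) (faceRep-sameOrbit (corner i j)) s)))
    ... | no ¬corner = contradiction (i , j , sameOrbit-sym (φ M) (φ-injective M) (faceRep-sameOrbit (corner i j))) ¬corner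

    faceLabel-unmarked : ∀ d i j → faceLabel d ≡ inj₁ (i , j) → SameOrbit (φ M) d (corner i j)
    faceLabel-unmarked d i j eq with Finₚ.any? (λ i′ → Finₚ.any? λ j′ → sameOrbit? (φ M) (faceRep d) (corner i′ j′))
    faceLabel-unmarked d i j refl | yes (_ , _ , s) = sameOrbit-trans (φ M) (faceRep-sameOrbit d) s

    code : Code D
    code = σ M , α M , colour M , faceLabel , cilium

    encode-valid : ∀ {c} → code ≈ c → Valid c
    encode-valid eq@(σ≗ , α≗ , col≗ , face≗ , _) =
        wellFormed-respects σ≗ α≗ col≗ face≗ (wellFormed-of M adm genus degree faceLabel faceLabel-φ)
      , ciliated-respects eq (noSquare , cilium-white , cilium-distinct , white-labelled , cilium-deg , star
                              , faceLabel-marked , faceLabel-unmarked)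

    decode-encode : ∀ {c} (eq : code ≈ c) (v : Valid c) → SIso A r N λs g δ x (decode c v)
    decode-encode (σ≗ , α≗ , col≗ , face≗ , cil≗) (w , _) =
      identity-iso M w σ≗ α≗ col≗ (λ d → trans (cong interp (sym (face≗ d))) (faceLabel-dec d)) , cil≗

    size-bound : D ≤ (n + (∣ δ ∣ + 2)) * 6 + 1
    size-bound = darts-bound M adm label label-injective {g = g} genus degree
      where
      isWhite : ∀ {d} → colour M d ≢ black → colour M d ≡ white
      isWhite {d} nb = nonBlack-nonSquare⇒white nb (noSquare d)
      label : ∀ d → colour M d ≢ black → Fin n
      label d nb = proj₁ (white-labelled d (isWhite nb))
      label-injective : ∀ {d d′} p p′ → label d p ≡ label d′ p′ → SameOrbit (σ M) d d′
      label-injective {d} {d′} p p′ eq =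
        sameOrbit-trans (σ M) (sameOrbit-sym (σ M) (σ-inj M) (proj₂ (white-labelled d (isWhite p))))
          (subst (λ i → SameOrbit (σ M) (cilium i) d′) (sym eq) (proj₂ (white-labelled d′ (isWhite p′))))

  coding : Coding (SMap A r N λs g δ n k S) (SIso A r N λs g δ)
  coding = record
    { size = SMap.D ; bound = (n + (∣ δ ∣ + 2)) * 6 + 1 ; size≤bound = Encoding.size-bound
    ; Code = Code ; _≈_ = _≈_ ; codes = codes ; Valid = Valid ; valid? = valid? ; decode = decode
    ; encode = Encoding.code ; encode-valid = Encoding.encode-valid ; decode-encode = Encoding.decode-encode }

mainTheorem10 : (A : Set) (r : ℕ) → 2 ≤ r → (N : ℕ) (λs : Fin N → A) →
    (g n : ℕ) → (0<n : 0 < n) → (δ : ℤ) → (u : A) → (z : Fin n → A) →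
    (k : Fin n → ℕ) → (∀ i → 1 ≤ k i) → (S : (i : Fin n) → Fin (k i) → A) →
      FiniteUpTo (FMap A r N λs g δ n z) (FIso A r N λs g δ)
    × FiniteUpTo (WMap A r N λs g δ n z) (WIso A r N λs g δ)
    × FiniteUpTo (UMap A r N λs g δ n 0<n u z) (UIso A r N λs g δ)
    × FiniteUpTo (SMap A r N λs g δ n k S) (SIso A r N λs g δ)
mainTheorem10 A r _ N λs g n 0<n δ u z k _ S =
    finite-by-coding (FFamily.coding A r N λs g δ n z)
  , finite-by-coding (WFamily.coding A r N λs g δ n z)
  , finite-by-coding (UFamily.coding A r N λs g δ n 0<n u z)
  , finite-by-coding (SFamily.coding A r N λs g δ n k S)
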